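{- Let $q$ be rational, $\delta=q^2-4$, $p$ an odd prime with $p\notin\mathcal D(q)$, and $\xi(p)$ the index of appearance. If $(\delta|p)\neq0$ then $2\xi(p)$ divides $p-(\delta|p)$. If $(q+2|p)=-1$ then $\frac{p-(\delta|p)}{2\xi(p)}$ is odd. If $p\notin\Pi_0(q)$ and $\frac{p-(\delta|p)}{2\xi(p)}$ is odd, then $(q+2|p)=-1$. If $p-(\delta|p)\equiv2\pmod4$ then $\xi(p)$ is odd. If $p-(\delta|p)=2r$ for a prime $r$ then $\xi(p)=r$. If $(\delta|p)=0$ then $\xi(p)=p$.
   Context: Chebyshev polynomials: $U_0=0$, $U_1=1$, $U_{n+1}=qU_n-U_{n-1}$; for odd $n=2k+1$, $W_n=U_{k+1}+U_k$. For rational $q=a/b$ in lowest terms, $\mathcal D(q)$ is the set of prime divisors of $b$; congruences mod $p\nmid b$ are in $\mathbb F_p$. Legendre symbol of a rational $x=a/b$ (lowest terms) at an odd prime $p\nmid b$: $(x|p)=1$ if $ab$ is a nonzero quadratic residue mod $p$, $-1$ if a nonresidue, $0$ if $p\mid a$. $p\in\Pi_0(q)$ if $W_n(q)\equiv0\bmod p$ for some odd $n\ge1$. The index of appearance $\xi(p)$ is the smallest integer $k\ge1$ with $U_k(q)\equiv0\pmod p$. -}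

module Defs where

open import Data.Nat as ℕ using (ℕ; zero; suc; _≤_; _<_)
open import Data.Nat.Divisibility as ℕD using (_∣?_)
open import Data.Integer as ℤ using (ℤ; +_; ∣_∣)
open import Data.Integer.Divisibility as ℤD using ()
open import Data.Rational as ℚ using (ℚ; ↥_; ↧ₙ_; 0ℚ; 1ℚ; _/_)
open import Data.Fin using (Fin; toℕ)
open import Data.Fin.Properties using (any?)
open import Data.Product using (∃; _×_)
open import Relation.Nullary using (¬_; yes; no)

U : ℚ → ℕ → ℚ
U q zero = 0ℚ
U q (suc zero) = 1ℚ
U q (suc (suc n)) = (q ℚ.* U q (suc n)) ℚ.- U q n

-- W q k is W_n(q) for the odd index n = 2k+1, i.e. U_{k+1}(q) + U_k(q).
W : ℚ → ℕ → ℚ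
W q k = U q (suc k) ℚ.+ U q k

InD : ℚ → ℕ → Set
InD q p = p ℕD.∣ ↧ₙ q

-- x ≡ 0 mod p, for a rational x whose reduced denominator is prime to p
-- (the case in which it is used): p divides the reduced numerator of x.
_≡0mod_ : ℚ → ℕ → Set
x ≡0mod p = (+ p) ℤD.∣ (↥ x)

InΠ₀ : ℚ → ℕ → Set
InΠ₀ q p = ∃ λ (k : ℕ) → W q k ≡0mod p

IsIndexOfAppearance : ℚ → ℕ → ℕ → Set
IsIndexOfAppearance q p k =
  1 ≤ k × U q k ≡0mod p × (∀ j → 1 ≤ j → j < k → ¬ (U q j ≡0mod p))

-- Legendre symbol (x | p) of a rational x = a/b (lowest terms):
-- 0 if p ∣ a; 1 if a*b is a nonzero square mod p; -1 otherwise.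
legendre : ℚ → ℕ → ℤ
legendre x p with p ∣? ∣ ↥ x ∣
... | yes _ = + 0
... | no _ with any? {n = p} (λ (y : Fin p) → p ∣? ∣ (+ toℕ y ℤ.* + toℕ y) ℤ.- (↥ x ℤ.* + ↧ₙ x) ∣)
...   | yes _ = + 1
...   | no _ = ℤ.-[1+ 0 ]

δ : ℚ → ℚ
δ q = (q ℚ.* q) ℚ.- (+ 4 / 1)

q+2 : ℚ → ℚ
q+2 q = q ℚ.+ (+ 2 / 1)

OddInt : ℤ → Set
OddInt m = ¬ ((+ 2) ℤD.∣ m)

{-# OPTIONS --safe #-}
module Submission where

-- Reduce q to Q ∈ 𝔽ₚ and compute in ℤ[α]/(p), α² = Qα − 1, where α^(n+1) = −Uₙ + Uₙ₊₁α: so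
-- p ∣ Uₙ exactly when α^n is a scalar, and ξ(p) is the least such n, with α^ξ(p) = c and c² = 1
-- because α has norm 1. Frobenius applied to 2α = Q + √D, where D = Q² − 4, and to w = 1 + α,
-- where w² = (Q+2)α, yields through Euler's criterion α^h = (Q+2|p) for h = (p − (D|p))/2.
-- Hence h = ξ(p)·M with c^M = (Q+2|p), from which the divisibility and parity claims follow.
-- When D ≡ 0 we have Q ≡ ±2 and Uₙ ≡ n(±1)^(n+1), so ξ(p) = p.

open import Defs
open import Level using (0ℓ)
open import Algebra.Bundles using (CommutativeSemiring)
import Algebra.Definitions.RawMonoid as RawMonoidDefinitions
open import Algebra.Definitions using (Congruent₂)
open import Algebra.Structures using (IsCommutativeMonoid)
open import Algebra.Structures.Biased using (IsCommutativeSemiringˡ)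
open import Data.Empty using (⊥; ⊥-elim)
open import Data.Fin as Fin using (Fin; zero; suc; toℕ; inject₁; fromℕ; fromℕ<)
open import Data.Fin.Properties as FinP using (any?)
open import Data.Integer as ℤ using (ℤ; +_; -[1+_]; 0ℤ; 1ℤ; -1ℤ)
import Data.Integer.Properties as ℤP
import Data.Integer.DivMod as ℤDM
open import Data.Integer.Divisibility as ℤD using ()
open import Data.Integer.Divisibility.Signed as ℤS using (divides)
open import Data.Integer.Tactic.RingSolver using (solve-∀)
open import Data.List using (List; []; _∷_; length; replicate)
import Data.List.Properties as ListP
open import Data.List.Relation.Unary.All using (All; []; _∷_)
open import Data.List.Relation.Unary.AllPairs using (AllPairs; []; _∷_)
open import Data.Nat as ℕ using (ℕ; zero; suc)
import Data.Nat.Properties as ℕP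
open import Data.Nat.Combinatorics using (_C_; nCk+nC[k+1]≡[n+1]C[k+1]; nC1≡n; nCn≡1)
open import Data.Nat.Divisibility as ℕD using ()
import Data.Nat.DivMod as ℕDM
import Data.Nat.Tactic.RingSolver as ℕS
open import Data.Nat.Primality using (Prime; euclidsLemma; prime⇒nonZero; prime⇒nonTrivial; prime⇒irreducible)
open import Data.Product using (Σ; ∃; _×_; _,_; proj₁; proj₂)
open import Data.Rational as ℚ using (ℚ; ↥_; ↧_; ↧ₙ_; 0ℚ; 1ℚ; _/_)
import Data.Rational.Properties as ℚP
open import Data.Sum as Sum using (_⊎_; inj₁; inj₂; [_,_]′)
open import Function using (id; _∘_)
open import Relation.Binary.Bundles using (Setoid)
open import Relation.Binary.Structures using (IsEquivalence)
open import Relation.Nullary using (¬_; yes; no)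
open import Relation.Binary.PropositionalEquality
  using (_≡_; _≢_; refl; sym; trans; cong; cong₂; subst; subst₂; module ≡-Reasoning)

square-^ : ∀ s n → (s ℤ.* s) ℤ.^ n ≡ s ℤ.^ (n ℕ.+ n)
square-^ s zero = refl
square-^ s (suc n) = begin
  (s ℤ.* s) ℤ.* (s ℤ.* s) ℤ.^ n       ≡⟨ cong ((s ℤ.* s) ℤ.*_) (square-^ s n) ⟩
  (s ℤ.* s) ℤ.* s ℤ.^ (n ℕ.+ n)       ≡⟨ ℤP.*-assoc s s _ ⟩
  s ℤ.* s ℤ.^ suc (n ℕ.+ n)           ≡⟨ cong (λ k → s ℤ.* s ℤ.^ k) (ℕP.+-suc n n) ⟨
  s ℤ.^ (suc n ℕ.+ suc n) ∎
  where open ≡-Reasoning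

2∤1 : ¬ 2 ℕD.∣ 1
2∤1 2∣1 = ℕP.<-irrefl refl (ℕD.∣⇒≤ 2∣1)

2∤1+2m : ∀ m → ¬ 2 ℕD.∣ suc (m ℕ.+ m)
2∤1+2m m 2∣1+2m = 2∤1 (ℕD.∣m+n∣m⇒∣n (subst (2 ℕD.∣_) (ℕP.+-comm 1 (m ℕ.+ m)) 2∣1+2m)
                                        (ℕD.divides m (trans (cong (m ℕ.+_) (sym (ℕP.+-identityʳ m))) (ℕP.*-comm 2 m))))

4x≢4t+2 : ∀ x t → + 4 ℤ.* x ≢ + 4 ℤ.* t ℤ.+ + 2
4x≢4t+2 x t 4x≡4t+2 = 2∤1 (ℤS.∣⇒∣ᵤ (ℤS.divides (x ℤ.- t) (sym 2[x-t]≡1)))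
  where
  open import Data.Integer.Base using (_+_; _*_; _-_)
  halve : ∀ x t → + 2 * (+ 2 * (x - t)) ≡ + 4 * x - + 4 * t
  halve = solve-∀
  cancel : ∀ t → (+ 4 * t + + 2) - + 4 * t ≡ + 2 * 1ℤ
  cancel = solve-∀
  2[x-t]≡1 : (x - t) * + 2 ≡ 1ℤ
  2[x-t]≡1 = trans (ℤP.*-comm (x - t) (+ 2)) (ℤP.*-cancelˡ-≡ (+ 2) (+ 2 * (x - t)) 1ℤ
               (trans (halve x t) (trans (cong (_- + 4 * t) 4x≡4t+2) (cancel t))))

data EvenOdd : ℕ → Set where
  even : ∀ j → EvenOdd (j ℕ.+ j)
  odd : ∀ j → EvenOdd (suc (j ℕ.+ j))

evenOdd : ∀ n → EvenOdd n
evenOdd zero = even 0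
evenOdd (suc n) with evenOdd n
... | even j = odd j
... | odd j = subst EvenOdd (cong suc (ℕP.+-suc j j)) (even (suc j))

odd-prime : ∀ {p} → Prime p → p ≢ 2 → ∃ λ m → p ≡ suc (m ℕ.+ m)
odd-prime {p} p-prime p≢2 = half p refl (evenOdd p)
  where
  half : ∀ n → n ≡ p → EvenOdd n → ∃ λ m → p ≡ suc (m ℕ.+ m)
  half _ n≡p (odd j) = j , sym n≡p
  half _ n≡p (even j) with prime⇒irreducible p-prime (ℕD.divides j (trans (sym n≡p) (j+j≡j*2 j)))
    where j+j≡j*2 : ∀ j → j ℕ.+ j ≡ j ℕ.* 2
          j+j≡j*2 j = trans (cong (j ℕ.+_) (sym (ℕP.+-identityʳ j))) (ℕP.*-comm 2 j)
  ... | inj₁ ()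
  ... | inj₂ 2≡p = ⊥-elim (p≢2 (sym 2≡p))

binomial-absorption : ∀ n k → suc k ℕ.* (suc n C suc k) ≡ suc n ℕ.* (n C k)
binomial-absorption zero zero = refl
binomial-absorption zero (suc k) = ℕP.*-zeroʳ (suc (suc k))
binomial-absorption (suc n) zero =
  trans (ℕP.+-identityʳ _) (trans (nC1≡n (suc (suc n))) (sym (ℕP.*-identityʳ (suc (suc n)))))
binomial-absorption (suc n) (suc k) = begin
  suc (suc k) ℕ.* (suc (suc n) C suc (suc k))
    ≡⟨ cong (suc (suc k) ℕ.*_) (nCk+nC[k+1]≡[n+1]C[k+1] (suc n) (suc k)) ⟨
  suc (suc k) ℕ.* (A ℕ.+ B)
    ≡⟨ regroup k A B ⟩
  A ℕ.+ suc k ℕ.* A ℕ.+ suc (suc k) ℕ.* B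
    ≡⟨ cong₂ (λ a b → A ℕ.+ a ℕ.+ b) (binomial-absorption n k) (binomial-absorption n (suc k)) ⟩
  A ℕ.+ suc n ℕ.* (n C k) ℕ.+ suc n ℕ.* (n C suc k)
    ≡⟨ factor A n (n C k) (n C suc k) ⟩
  A ℕ.+ suc n ℕ.* (n C k ℕ.+ n C suc k)
    ≡⟨ cong (λ z → A ℕ.+ suc n ℕ.* z) (nCk+nC[k+1]≡[n+1]C[k+1] n k) ⟩
  suc (suc n) ℕ.* A ∎
  where
  open ≡-Reasoning
  A B : ℕ
  A = suc n C suc k
  B = suc n C suc (suc k)
  regroup : ∀ k A B → suc (suc k) ℕ.* (A ℕ.+ B) ≡ A ℕ.+ suc k ℕ.* A ℕ.+ suc (suc k) ℕ.* B
  regroup = ℕS.solve-∀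
  factor : ∀ A n a b → A ℕ.+ suc n ℕ.* a ℕ.+ suc n ℕ.* b ≡ A ℕ.+ suc n ℕ.* (a ℕ.+ b)
  factor = ℕS.solve-∀

prime∣binomial : ∀ {n} → Prime (suc n) → ∀ k → suc k ℕ.< suc n → suc n ℕD.∣ suc n C suc k
prime∣binomial {n} p-prime k k<n
  with euclidsLemma (suc k) (suc n C suc k) p-prime
         (ℕD.divides (n C k) (trans (binomial-absorption n k) (ℕP.*-comm (suc n) (n C k))))
... | inj₁ p∣k = ⊥-elim (ℕD.>⇒∤ k<n p∣k)
... | inj₂ p∣C = p∣C

module Frobenius {c ℓ} (S : CommutativeSemiring c ℓ) where

  open CommutativeSemiring S hiding (refl; sym; zero) renaming (trans to ≈-trans)
  open RawMonoidDefinitions +-rawMonoid using () renaming (_×_ to _·_)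
  open import Algebra.Properties.Semiring.Exp semiring using (_^_)
  open import Algebra.Properties.Semiring.Mult semiring using (×-assocˡ; ×-congʳ)
  open import Algebra.Properties.Monoid.Sum +-monoid
    using (sum; sum-init-last; sum-cong-≋; sum-replicate; sum-replicate-zero)
  open import Algebra.Properties.CommutativeSemiring.Binomial S using (theorem; binomialTerm)
  open import Relation.Binary.Reasoning.Setoid setoid

  module _ (p : ℕ) (p-prime : Prime p) (characteristic : ∀ x → p · x ≈ 0#) where

    multiple-of-characteristic : ∀ n x → p ℕD.∣ n → n · x ≈ 0#
    multiple-of-characteristic n x (ℕD.divides q refl) = begin
      (q ℕ.* p) · x        ≈⟨ ×-assocˡ x q p ⟨
      q · (p · x)          ≈⟨ ×-congʳ q (characteristic x) ⟩
      q · 0#               ≈⟨ sum-replicate q ⟨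
      sum {q} (λ _ → 0#)   ≈⟨ sum-replicate-zero q ⟩
      0# ∎

    frobenius : ∀ x y → (x + y) ^ p ≈ x ^ p + y ^ p
    frobenius = expand (ℕ.pred p) (ℕP.suc-pred p {{prime⇒nonZero p-prime}})
      where
      expand : ∀ n → suc n ≡ p → ∀ x y → (x + y) ^ p ≈ x ^ p + y ^ p
      expand n refl x y = begin
        (x + y) ^ p                 ≈⟨ theorem p x y ⟩
        t zero + sum (λ i → t (suc i))
          ≈⟨ +-cong (+-identityʳ _) (sum-init-last (λ i → t (suc i))) ⟩
        1# * y ^ p + (sum (λ i → t (suc (inject₁ i))) + t (fromℕ p))
          ≈⟨ +-cong (*-identityˡ _) (+-cong inner≈0 (last-term p)) ⟩
        y ^ p + (0# + x ^ p)        ≈⟨ +-congˡ (+-identityˡ _) ⟩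
        y ^ p + x ^ p               ≈⟨ +-comm _ _ ⟩
        x ^ p + y ^ p ∎
        where
        t : Fin (suc p) → Carrier
        t = binomialTerm x y p
        inner≈0 : sum (λ i → t (suc (inject₁ i))) ≈ 0#
        inner≈0 = ≈-trans (sum-cong-≋ λ i → multiple-of-characteristic _ _
                           (prime∣binomial p-prime (toℕ (inject₁ i))
                             (ℕ.s≤s (subst (ℕ._< n) (sym (FinP.toℕ-inject₁ i)) (FinP.toℕ<n i)))))
                        (sum-replicate-zero n)
        last-term : ∀ m → binomialTerm x y m (fromℕ m) ≈ x ^ m
        last-term m rewrite FinP.toℕ-fromℕ m | nCn≡1 m | ℕP.n∸n≡0 m =
          ≈-trans (+-identityʳ _) (*-identityʳ _)

module Congruence (p : ℕ) where

  open import Data.Integer.Base using (_+_; _*_; _-_; -_)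

  infix 4 _≈_
  record _≈_ (a b : ℤ) : Set where
    constructor mk≈
    field p∣a-b : + p ℤS.∣ a - b

  private
    by : ∀ {x y} → x ≡ y → + p ℤS.∣ x → + p ℤS.∣ y
    by = subst (+ p ℤS.∣_)

  ≈-refl : ∀ {a} → a ≈ a
  ≈-refl {a} = mk≈ (by (sym (ℤP.+-inverseʳ a)) (divides 0ℤ refl))

  ≈-reflexive : ∀ {a b} → a ≡ b → a ≈ b
  ≈-reflexive refl = ≈-refl

  ≈-sym : ∀ {a b} → a ≈ b → b ≈ a
  ≈-sym {a} {b} (mk≈ d) = mk≈ (by (swap a b) (ℤS.∣m⇒∣-m d))
    where swap : ∀ a b → - (a - b) ≡ b - a
          swap = solve-∀

  ≈-trans : ∀ {a b c} → a ≈ b → b ≈ c → a ≈ c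
  ≈-trans {a} {b} {c} (mk≈ d) (mk≈ e) = mk≈ (by (ℤP.+-minus-telescope a b c) (ℤS.∣m∣n⇒∣m+n d e))

  ≈-isEquivalence : IsEquivalence _≈_
  ≈-isEquivalence = record { refl = ≈-refl ; sym = ≈-sym ; trans = ≈-trans }

  ≈-setoid : Setoid 0ℓ 0ℓ
  ≈-setoid = record { isEquivalence = ≈-isEquivalence }

  +-cong : Congruent₂ _≈_ _+_
  +-cong {a} {a′} {b} {b′} (mk≈ d) (mk≈ e) = mk≈ (by (split a a′ b b′) (ℤS.∣m∣n⇒∣m+n d e))
    where split : ∀ a a′ b b′ → (a - a′) + (b - b′) ≡ (a + b) - (a′ + b′)
          split = solve-∀

  *-cong : Congruent₂ _≈_ _*_
  *-cong {a} {a′} {b} {b′} (mk≈ d) (mk≈ e) =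
    mk≈ (by (split a a′ b b′) (ℤS.∣m∣n⇒∣m+n (ℤS.∣m⇒∣m*n b d) (ℤS.∣n⇒∣m*n a′ e)))
    where split : ∀ a a′ b b′ → (a - a′) * b + a′ * (b - b′) ≡ a * b - a′ * b′
          split = solve-∀

  -‿cong : ∀ {a a′} → a ≈ a′ → - a ≈ - a′
  -‿cong {a} {a′} (mk≈ d) = mk≈ (by (split a a′) (ℤS.∣m⇒∣-m d))
    where split : ∀ a a′ → - (a - a′) ≡ - a - - a′
          split = solve-∀

  -cong : Congruent₂ _≈_ _-_
  -cong d e = +-cong d (-‿cong e)

  ≈0⇔∣ : ∀ {a} → (a ≈ 0ℤ → + p ℤD.∣ a) × (+ p ℤD.∣ a → a ≈ 0ℤ)
  ≈0⇔∣ {a} = (λ (mk≈ d) → ℤS.∣⇒∣ᵤ (by (ℤP.+-identityʳ a) d))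
           , (λ d → mk≈ (by (sym (ℤP.+-identityʳ a)) (ℤS.∣ᵤ⇒∣ d)))

  multiple≈0 : ∀ k → k * + p ≈ 0ℤ
  multiple≈0 k = proj₂ ≈0⇔∣ (ℤS.∣⇒∣ᵤ (ℤS.∣n⇒∣m*n k ℤS.∣-refl))

  private
    coarsen : ∀ {_∙_ ε} → IsCommutativeMonoid _≡_ _∙_ ε → Congruent₂ _≈_ _∙_ →
              IsCommutativeMonoid _≈_ _∙_ ε
    coarsen M ∙-cong = record
      { isMonoid = record
        { isSemigroup = record
          { isMagma = record { isEquivalence = ≈-isEquivalence ; ∙-cong = ∙-cong }
          ; assoc = λ x y z → ≈-reflexive (M.assoc x y z) }
        ; identity = (λ x → ≈-reflexive (proj₁ M.identity x)) , (λ x → ≈-reflexive (proj₂ M.identity x)) }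
      ; comm = λ x y → ≈-reflexive (M.comm x y) }
      where module M = IsCommutativeMonoid M

  ℤ/p : CommutativeSemiring 0ℓ 0ℓ
  ℤ/p = record
    { isCommutativeSemiring = IsCommutativeSemiringˡ.isCommutativeSemiring record
      { +-isCommutativeMonoid = coarsen ℤP.+-0-isCommutativeMonoid +-cong
      ; *-isCommutativeMonoid = coarsen ℤP.*-1-isCommutativeMonoid *-cong
      ; distribʳ = λ x y z → ≈-reflexive (ℤP.*-distribʳ-+ x y z)
      ; zeroˡ = λ x → ≈-reflexive (ℤP.*-zeroˡ x) } }

module PrimeModulus (p : ℕ) (p-prime : Prime p) where

  open Congruence p public
  open import Data.Integer.Base using (_+_; _*_; _-_; -_; _^_)
  open CommutativeSemiring ℤ/p using () renaming (+-rawMonoid to ℤ/p-+-rawMonoid)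
  open RawMonoidDefinitions ℤ/p-+-rawMonoid using () renaming (_×_ to _·_)
  import Algebra.Properties.Semiring.Exp (CommutativeSemiring.semiring ℤ/p) as ℤ/p

  instance
    p-nonZero : ℕ.NonZero p
    p-nonZero = prime⇒nonZero p-prime

  1<p : 1 ℕ.< p
  1<p = ℕ.nonTrivial⇒n>1 p {{prime⇒nonTrivial p-prime}}

  ≈0-product : ∀ a b → a * b ≈ 0ℤ → a ≈ 0ℤ ⊎ b ≈ 0ℤ
  ≈0-product a b ab≈0
    with euclidsLemma ℤ.∣ a ∣ ℤ.∣ b ∣ p-prime (subst (p ℕD.∣_) (ℤP.abs-* a b) (proj₁ ≈0⇔∣ ab≈0))
  ... | inj₁ p∣a = inj₁ (proj₂ ≈0⇔∣ p∣a)
  ... | inj₂ p∣b = inj₂ (proj₂ ≈0⇔∣ p∣b)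

  *-≉0 : ∀ {a b} → ¬ a ≈ 0ℤ → ¬ b ≈ 0ℤ → ¬ a * b ≈ 0ℤ
  *-≉0 {a} {b} a≉0 b≉0 ab≈0 with ≈0-product a b ab≈0
  ... | inj₁ a≈0 = a≉0 a≈0
  ... | inj₂ b≈0 = b≉0 b≈0

  ≈⇒-≈0 : ∀ {a b} → a ≈ b → a - b ≈ 0ℤ
  ≈⇒-≈0 {a} {b} a≈b = ≈-trans (-cong a≈b (≈-refl {b})) (≈-reflexive (ℤP.+-inverseʳ b))

  -≈0⇒≈ : ∀ a b → a - b ≈ 0ℤ → a ≈ b
  -≈0⇒≈ a b a-b≈0 = ≈-trans (≈-reflexive (move a b)) (≈-trans (+-cong a-b≈0 (≈-refl {b})) (≈-reflexive (ℤP.+-identityˡ b)))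
    where move : ∀ a b → a ≡ (a - b) + b
          move = solve-∀

  *-cancelˡ : ∀ {c a b} → ¬ c ≈ 0ℤ → c * a ≈ c * b → a ≈ b
  *-cancelˡ {c} {a} {b} c≉0 ca≈cb =
    [ (λ c≈0 → ⊥-elim (c≉0 c≈0)) , -≈0⇒≈ a b ]′
      (≈0-product c (a - b) (≈-trans (≈-reflexive (distrib c a b)) (≈⇒-≈0 ca≈cb)))
    where distrib : ∀ c a b → c * (a - b) ≡ c * a - c * b
          distrib = solve-∀

  small≉0 : ∀ {n} → 0 ℕ.< n → n ℕ.< p → ¬ + n ≈ 0ℤ
  small≉0 0<n n<p n≈0 = ℕD.>⇒∤ {{ℕ.>-nonZero 0<n}} n<p (proj₁ ≈0⇔∣ n≈0)

  1≉0 : ¬ 1ℤ ≈ 0ℤ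
  1≉0 = small≉0 (ℕ.s≤s ℕ.z≤n) 1<p

  ^-≉0 : ∀ {a} n → ¬ a ≈ 0ℤ → ¬ a ^ n ≈ 0ℤ
  ^-≉0 zero a≉0 = 1≉0
  ^-≉0 (suc n) a≉0 = *-≉0 a≉0 (^-≉0 n a≉0)

  ^-cong : ∀ {a b} n → a ≈ b → a ^ n ≈ b ^ n
  ^-cong zero a≈b = ≈-refl
  ^-cong (suc n) a≈b = *-cong a≈b (^-cong n a≈b)

  square≈1 : ∀ x → x * x ≈ 1ℤ → x ≈ 1ℤ ⊎ x ≈ -1ℤ
  square≈1 x xx≈1 = Sum.map (-≈0⇒≈ x 1ℤ) (-≈0⇒≈ x -1ℤ)
    (≈0-product (x - 1ℤ) (x + 1ℤ) (≈-trans (≈-reflexive (difference-of-squares x)) (≈⇒-≈0 xx≈1)))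
    where difference-of-squares : ∀ x → (x - 1ℤ) * (x + 1ℤ) ≡ x * x - 1ℤ
          difference-of-squares = solve-∀

  private
    ·≡* : ∀ n x → n · x ≡ + n * x
    ·≡* zero x = sym (ℤP.*-zeroˡ x)
    ·≡* (suc n) x = trans (cong (_+_ x) (·≡* n x)) (sym (ℤP.suc-* (+ n) x))

    ^≡^ : ∀ x n → x ^ n ≡ x ℤ/p.^ n
    ^≡^ x zero = refl
    ^≡^ x (suc n) = cong (x *_) (^≡^ x n)

    characteristic : ∀ x → p · x ≈ 0ℤ
    characteristic x = ≈-trans (≈-reflexive (trans (·≡* p x) (ℤP.*-comm (+ p) x))) (multiple≈0 x)

  freshman : ∀ x y → (x + y) ^ p ≈ x ^ p + y ^ p
  freshman x y rewrite ^≡^ (x + y) p | ^≡^ x p | ^≡^ y p = frobenius p p-prime characteristic x y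
    where open Frobenius ℤ/p using (frobenius)

  ≈-%ℕ : ∀ a → a ≈ + (a ℤDM.%ℕ p)
  ≈-%ℕ a = mk≈ (divides (a ℤDM./ℕ p)
    (trans (cong (_- + r) (ℤDM.a≡a%ℕn+[a/ℕn]*n a p)) (cancel (+ r) (a ℤDM./ℕ p) (+ p))))
    where r : ℕ
          r = a ℤDM.%ℕ p
          cancel : ∀ r q p → (r + q * p) - r ≡ q * p
          cancel = solve-∀

  fermat : ∀ a → a ^ p ≈ a
  fermat a = ≈-trans (^-cong p (≈-%ℕ a)) (≈-trans (fermat-ℕ (a ℤDM.%ℕ p)) (≈-sym (≈-%ℕ a)))
    where
    fermat-ℕ : ∀ n → (+ n) ^ p ≈ + n
    fermat-ℕ zero = ≈-reflexive (subst (λ k → 0ℤ ^ k ≡ 0ℤ) (ℕP.suc-pred p) (ℤP.*-zeroˡ (0ℤ ^ ℕ.pred p)))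
    fermat-ℕ (suc n) = ≈-trans (freshman 1ℤ (+ n)) (+-cong (≈-reflexive (ℤP.^-zeroˡ p)) (fermat-ℕ n))

  fermat-little : ∀ {a} → ¬ a ≈ 0ℤ → a ^ ℕ.pred p ≈ 1ℤ
  fermat-little {a} a≉0 = *-cancelˡ a≉0
    (≈-trans (≈-reflexive (cong (a ^_) (ℕP.suc-pred p))) (≈-trans (fermat a) (≈-reflexive (sym (ℤP.*-identityʳ a)))))

  -- The monic polynomial c₀ + X (c₁ + X (⋯ (cₙ₋₁ + X))) of degree n, given by its lower coefficients.
  evalMonic : List ℤ → ℤ → ℤ
  evalMonic [] x = 1ℤ
  evalMonic (c ∷ cs) x = c + x * evalMonic cs x

  IsRoot : List ℤ → ℤ → Set
  IsRoot f x = evalMonic f x ≈ 0ℤ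

  Distinct : List ℤ → Set
  Distinct = AllPairs (λ r s → ¬ r ≈ s)

  deflate : List ℤ → ℤ → List ℤ
  deflate [] r = []
  deflate (c ∷ []) r = []
  deflate (c ∷ c′ ∷ cs) r = evalMonic (c′ ∷ cs) r ∷ deflate (c′ ∷ cs) r

  deflate-spec : ∀ c cs x r →
    evalMonic (c ∷ cs) x ≡ (x - r) * evalMonic (deflate (c ∷ cs) r) x + evalMonic (c ∷ cs) r
  deflate-spec c [] x r = linear c x r
    where linear : ∀ c x r → c + x * 1ℤ ≡ (x - r) * 1ℤ + (c + r * 1ℤ)
          linear = solve-∀
  deflate-spec c (c′ ∷ cs) x r =
    trans (cong (λ z → c + x * z) (deflate-spec c′ cs x r))
          (horner c x r (evalMonic (deflate (c′ ∷ cs) r) x) (evalMonic (c′ ∷ cs) r))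
    where horner : ∀ c x r g fr → c + x * ((x - r) * g + fr) ≡ (x - r) * (fr + x * g) + (c + r * fr)
          horner = solve-∀

  deflate-length : ∀ c cs r → length (deflate (c ∷ cs) r) ≡ length cs
  deflate-length c [] r = refl
  deflate-length c (c′ ∷ cs) r = cong suc (deflate-length c′ cs r)

  deflate-root : ∀ {c cs r s} → IsRoot (c ∷ cs) r → IsRoot (c ∷ cs) s → ¬ r ≈ s →
                 IsRoot (deflate (c ∷ cs) r) s
  deflate-root {c} {cs} {r} {s} fr≈0 fs≈0 r≉s =
    [ (λ s-r≈0 → ⊥-elim (r≉s (≈-sym (-≈0⇒≈ s r s-r≈0)))) , id ]′
      (≈0-product (s - r) q (≈-trans (≈-reflexive q-spec) (-cong fs≈0 fr≈0)))
    where
    q : ℤ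
    q = evalMonic (deflate (c ∷ cs) r) s
    q-spec : (s - r) * q ≡ evalMonic (c ∷ cs) s - evalMonic (c ∷ cs) r
    q-spec = sym (trans (cong (_- evalMonic (c ∷ cs) r) (deflate-spec c cs s r)) (cancel ((s - r) * q) (evalMonic (c ∷ cs) r)))
      where cancel : ∀ g fr → (g + fr) - fr ≡ g
            cancel = solve-∀

  roots≤degree : ∀ f rs → All (IsRoot f) rs → Distinct rs → length rs ℕ.≤ length f
  roots≤degree f [] _ _ = ℕ.z≤n
  roots≤degree [] (r ∷ rs) (1≈0 ∷ _) _ = ⊥-elim (1≉0 1≈0)
  roots≤degree (c ∷ cs) (r ∷ rs) (fr≈0 ∷ frs≈0) (r∉rs ∷ distinct) =
    subst (λ n → suc (length rs) ℕ.≤ suc n) (deflate-length c cs r)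
      (ℕ.s≤s (roots≤degree (deflate (c ∷ cs) r) rs
                (deflate-roots frs≈0 r∉rs) distinct))
    where deflate-roots : ∀ {ss} → All (IsRoot (c ∷ cs)) ss → All (λ s → ¬ r ≈ s) ss →
                          All (IsRoot (deflate (c ∷ cs) r)) ss
          deflate-roots [] [] = []
          deflate-roots {s ∷ _} (fs≈0 ∷ fss≈0) (r≉s ∷ r∉ss) =
            deflate-root {c} {cs} {r} {s} fr≈0 fs≈0 r≉s ∷ deflate-roots fss≈0 r∉ss

  IsSquare : ℤ → Set
  IsSquare a = ∃ λ s → s * s ≈ a

  data IsLegendre (a : ℤ) : ℤ → Set where
    divisible : a ≈ 0ℤ → IsLegendre a 0ℤ
    residue : ¬ a ≈ 0ℤ → IsSquare a → IsLegendre a 1ℤ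
    nonresidue : ¬ a ≈ 0ℤ → ¬ IsSquare a → IsLegendre a -1ℤ

  legendre-unit : ∀ {a L} → IsLegendre a L → ¬ a ≈ 0ℤ → L ≡ 1ℤ ⊎ L ≡ -1ℤ
  legendre-unit (divisible a≈0) a≉0 = ⊥-elim (a≉0 a≈0)
  legendre-unit (residue _ _) _ = inj₁ refl
  legendre-unit (nonresidue _ _) _ = inj₂ refl

  legendre-cases : ∀ {a L} → IsLegendre a L → (a ≈ 0ℤ × L ≡ 0ℤ) ⊎ ¬ a ≈ 0ℤ
  legendre-cases (divisible a≈0) = inj₁ (a≈0 , refl)
  legendre-cases (residue a≉0 _) = inj₂ a≉0
  legendre-cases (nonresidue a≉0 _) = inj₂ a≉0

  module Euler (m : ℕ) (p≡1+2m : p ≡ suc (m ℕ.+ m)) where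

    private
      fermat-little-m+m : ∀ {a} → ¬ a ≈ 0ℤ → a ^ (m ℕ.+ m) ≈ 1ℤ
      fermat-little-m+m {a} a≉0 = subst (λ n → a ^ n ≈ 1ℤ) (cong ℕ.pred p≡1+2m) (fermat-little a≉0)

      ≤m⇒<p : ∀ {i} → i ℕ.≤ m → i ℕ.< p
      ≤m⇒<p i≤m = subst (_ ℕ.<_) (sym p≡1+2m) (ℕ.s≤s (ℕP.≤-trans i≤m (ℕP.m≤m+n m m)))

    euler-± : ∀ {a} → ¬ a ≈ 0ℤ → a ^ m ≈ 1ℤ ⊎ a ^ m ≈ -1ℤ
    euler-± {a} a≉0 = square≈1 (a ^ m)
      (≈-trans (≈-reflexive (sym (ℤP.^-distribˡ-+-* a m m))) (fermat-little-m+m a≉0))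

    euler-square : ∀ {a} → IsSquare a → ¬ a ≈ 0ℤ → a ^ m ≈ 1ℤ
    euler-square {a} (s , ss≈a) a≉0 = ≈-trans (^-cong m (≈-sym ss≈a))
      (≈-trans (≈-reflexive (square-^ s m))
               (fermat-little-m+m s≉0))
      where s≉0 : ¬ s ≈ 0ℤ
            s≉0 s≈0 = a≉0 (≈-trans (≈-sym ss≈a) (*-cong s≈0 s≈0))

    squares : ℕ → List ℤ
    squares zero = []
    squares (suc i) = + suc i * + suc i ∷ squares i

    private
      squares-length : ∀ k → length (squares k) ≡ k
      squares-length zero = refl
      squares-length (suc k) = cong suc (squares-length k)

      all-squares : ∀ {P : ℤ → Set} k → (∀ {i} → 1 ℕ.≤ i → i ℕ.≤ k → P (+ i * + i)) → All P (squares k)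
      all-squares zero H = []
      all-squares (suc k) H = H (ℕ.s≤s ℕ.z≤n) ℕP.≤-refl ∷ all-squares k (λ 1≤i i≤k → H 1≤i (ℕP.m≤n⇒m≤1+n i≤k))

      i²≉j² : ∀ {i j} → 1 ℕ.≤ j → j ℕ.< i → i ℕ.≤ m → ¬ + i * + i ≈ + j * + j
      i²≉j² {i} {j} 1≤j j<i i≤m ii≈jj =
        [ small≉0 (ℕP.m<n⇒0<n∸m j<i) (ℕP.≤-<-trans (ℕP.m∸n≤m i j) (≤m⇒<p i≤m))
            ∘ subst (_≈ 0ℤ) (trans (ℤP.m-n≡m⊖n i j) (ℤP.⊖-≥ (ℕP.<⇒≤ j<i)))
        , small≉0 (ℕP.<-≤-trans 1≤j (ℕP.m≤n+m j i)) i+j<p ∘ subst (_≈ 0ℤ) (sym (ℤP.pos-+ i j)) ]′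
        (≈0-product (+ i - + j) (+ i + + j)
          (≈-trans (≈-reflexive (difference-of-squares (+ i) (+ j))) (≈⇒-≈0 ii≈jj)))
        where
        difference-of-squares : ∀ a b → (a - b) * (a + b) ≡ a * a - b * b
        difference-of-squares = solve-∀
        i+j<p : i ℕ.+ j ℕ.< p
        i+j<p = subst (i ℕ.+ j ℕ.<_) (sym p≡1+2m)
                  (ℕ.s≤s (ℕP.≤-trans (ℕP.<⇒≤ (ℕP.+-monoʳ-< i j<i)) (ℕP.+-mono-≤ i≤m i≤m)))

      squares-distinct : ∀ k → k ℕ.≤ m → Distinct (squares k)
      squares-distinct zero _ = []
      squares-distinct (suc k) 1+k≤m =
        all-squares k (λ 1≤j j≤k → i²≉j² 1≤j (ℕ.s≤s j≤k) 1+k≤m)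
        ∷ squares-distinct k (ℕP.<⇒≤ 1+k≤m)

      X^[1+_]-1 : ℕ → List ℤ
      X^[1+ k ]-1 = -1ℤ ∷ replicate k 0ℤ

      root-of-X^[1+k]-1 : ∀ k {x} → x ^ suc k ≈ 1ℤ → IsRoot X^[1+ k ]-1 x
      root-of-X^[1+k]-1 k {x} x^[1+k]≈1 =
        +-cong (≈-refl { -1ℤ}) (≈-trans (≈-reflexive (cong (x *_) (eval-zeros k))) x^[1+k]≈1)
        where eval-zeros : ∀ k → evalMonic (replicate k 0ℤ) x ≡ x ^ k
              eval-zeros zero = refl
              eval-zeros (suc k) = trans (ℤP.+-identityˡ _) (cong (x *_) (eval-zeros k))

    euler-nonsquare : ∀ {a} → ¬ IsSquare a → ¬ a ≈ 0ℤ → a ^ m ≈ -1ℤ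
    euler-nonsquare {a} a∉□ a≉0 = [ (λ a^m≈1 → ⊥-elim (too-many-roots m refl a^m≈1)) , id ]′ (euler-± a≉0)
      where
      -- 1², …, m² and a would be m + 1 distinct roots of X^m - 1.
      too-many-roots : ∀ k → k ≡ m → a ^ m ≈ 1ℤ → ⊥
      too-many-roots zero refl _ = ℕP.<-irrefl (sym p≡1+2m) 1<p
      too-many-roots (suc k) refl a^m≈1 = ℕP.<-irrefl refl
        (subst₂ (λ i j → suc i ℕ.≤ j) (squares-length m) (cong suc (ListP.length-replicate k))
          (roots≤degree X^[1+ k ]-1 (a ∷ squares m)
            (root-of-X^[1+k]-1 k {a} a^m≈1
              ∷ all-squares m (λ {i} 1≤i i≤m → root-of-X^[1+k]-1 k {+ i * + i}
                  (euler-square (+ i , ≈-refl) (*-≉0 (small≉0 1≤i (≤m⇒<p i≤m)) (small≉0 1≤i (≤m⇒<p i≤m))))))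
            (all-squares m (λ {i} _ _ a≈ii → a∉□ (+ i , ≈-sym a≈ii)) ∷ squares-distinct m ℕP.≤-refl)))

-- ℤ[α]/(p, α² - Qα + 1); ⟨ a , b ⟩ stands for a + bα.
module QuadraticRing (p : ℕ) (p-prime : Prime p) (Q : ℤ) where

  open PrimeModulus p p-prime
  open import Data.Integer.Base using (_+_; _*_; _-_; -_)

  record R : Set where
    constructor ⟨_,_⟩
    field re im : ℤ
  open R public

  infix 4 _≋_
  record _≋_ (x y : R) : Set where
    constructor mk≋
    field
      re≈ : re x ≈ re y
      im≈ : im x ≈ im y
  open _≋_ public

  infixl 6 _⊕_
  infixl 7 _⊗_
  _⊕_ : R → R → R
  x ⊕ y = ⟨ re x + re y , im x + im y ⟩

  _⊗_ : R → R → R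
  x ⊗ y = ⟨ re x * re y - im x * im y , re x * im y + im x * re y + Q * (im x * im y) ⟩

  𝟘 𝟙 α : R
  𝟘 = ⟨ 0ℤ , 0ℤ ⟩
  𝟙 = ⟨ 1ℤ , 0ℤ ⟩
  α = ⟨ 0ℤ , 1ℤ ⟩

  ι : ℤ → R
  ι a = ⟨ a , 0ℤ ⟩

  ≡⇒≋ : ∀ {x y} → re x ≡ re y → im x ≡ im y → x ≋ y
  ≡⇒≋ e f = mk≋ (≈-reflexive e) (≈-reflexive f)

  ≋-isEquivalence : IsEquivalence _≋_
  ≋-isEquivalence = record
    { refl = mk≋ ≈-refl ≈-refl
    ; sym = λ (mk≋ a b) → mk≋ (≈-sym a) (≈-sym b)
    ; trans = λ (mk≋ a b) (mk≋ c d) → mk≋ (≈-trans a c) (≈-trans b d) }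

  ⊕-cong : ∀ {x x′ y y′} → x ≋ x′ → y ≋ y′ → x ⊕ y ≋ x′ ⊕ y′
  ⊕-cong (mk≋ a b) (mk≋ c d) = mk≋ (+-cong a c) (+-cong b d)

  ⊗-cong : ∀ {x x′ y y′} → x ≋ x′ → y ≋ y′ → x ⊗ y ≋ x′ ⊗ y′
  ⊗-cong (mk≋ a b) (mk≋ c d) =
    mk≋ (-cong (*-cong a c) (*-cong b d)) (+-cong (+-cong (*-cong a d) (*-cong b c)) (*-cong (≈-refl {Q}) (*-cong b d)))

  private
    ⊕-isCommutativeMonoid : IsCommutativeMonoid _≋_ _⊕_ 𝟘
    ⊕-isCommutativeMonoid = record
      { isMonoid = record
        { isSemigroup = record
          { isMagma = record { isEquivalence = ≋-isEquivalence ; ∙-cong = ⊕-cong }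
          ; assoc = λ x y z → ≡⇒≋ (ℤP.+-assoc (re x) (re y) (re z)) (ℤP.+-assoc (im x) (im y) (im z)) }
        ; identity = (λ x → ≡⇒≋ (ℤP.+-identityˡ (re x)) (ℤP.+-identityˡ (im x)))
                   , (λ x → ≡⇒≋ (ℤP.+-identityʳ (re x)) (ℤP.+-identityʳ (im x))) }
      ; comm = λ x y → ≡⇒≋ (ℤP.+-comm (re x) (re y)) (ℤP.+-comm (im x) (im y)) }

    ⊗-isCommutativeMonoid : IsCommutativeMonoid _≋_ _⊗_ 𝟙
    ⊗-isCommutativeMonoid = record
      { isMonoid = record
        { isSemigroup = record
          { isMagma = record { isEquivalence = ≋-isEquivalence ; ∙-cong = ⊗-cong }
          ; assoc = λ x y z → ≡⇒≋ (assoc-re (re x) (im x) (re y) (im y) (re z) (im z) Q)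
                                   (assoc-im (re x) (im x) (re y) (im y) (re z) (im z) Q) }
        ; identity = (λ x → ≡⇒≋ (identityˡ-re (re x) (im x)) (identityˡ-im (re x) (im x) Q))
                   , (λ x → ≡⇒≋ (identityʳ-re (re x) (im x)) (identityʳ-im (re x) (im x) Q)) }
      ; comm = λ x y → ≡⇒≋ (comm-re (re x) (im x) (re y) (im y)) (comm-im (re x) (im x) (re y) (im y) Q) }
      where
      assoc-re : ∀ a b c d e f Q → (a * c - b * d) * e - (a * d + b * c + Q * (b * d)) * f
                                 ≡ a * (c * e - d * f) - b * (c * f + d * e + Q * (d * f))
      assoc-re = solve-∀
      assoc-im : ∀ a b c d e f Q →
        (a * c - b * d) * f + (a * d + b * c + Q * (b * d)) * e + Q * ((a * d + b * c + Q * (b * d)) * f)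
        ≡ a * (c * f + d * e + Q * (d * f)) + b * (c * e - d * f) + Q * (b * (c * f + d * e + Q * (d * f)))
      assoc-im = solve-∀
      identityˡ-re : ∀ a b → 1ℤ * a - 0ℤ * b ≡ a
      identityˡ-re = solve-∀
      identityˡ-im : ∀ a b Q → 1ℤ * b + 0ℤ * a + Q * (0ℤ * b) ≡ b
      identityˡ-im = solve-∀
      identityʳ-re : ∀ a b → a * 1ℤ - b * 0ℤ ≡ a
      identityʳ-re = solve-∀
      identityʳ-im : ∀ a b Q → a * 0ℤ + b * 1ℤ + Q * (b * 0ℤ) ≡ b
      identityʳ-im = solve-∀
      comm-re : ∀ a b c d → a * c - b * d ≡ c * a - d * b
      comm-re = solve-∀
      comm-im : ∀ a b c d Q → a * d + b * c + Q * (b * d) ≡ c * b + d * a + Q * (d * b)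
      comm-im = solve-∀

  ℛ : CommutativeSemiring 0ℓ 0ℓ
  ℛ = record
    { isCommutativeSemiring = IsCommutativeSemiringˡ.isCommutativeSemiring record
      { +-isCommutativeMonoid = ⊕-isCommutativeMonoid
      ; *-isCommutativeMonoid = ⊗-isCommutativeMonoid
      ; distribʳ = λ x y z → ≡⇒≋ (distrib-re (re x) (im x) (re y) (im y) (re z) (im z))
                                  (distrib-im (re x) (im x) (re y) (im y) (re z) (im z) Q)
      ; zeroˡ = λ x → ≡⇒≋ (zero-re (re x) (im x)) (zero-im (re x) (im x) Q) } }
    where
    distrib-re : ∀ a b c d e f → (c + e) * a - (d + f) * b ≡ (c * a - d * b) + (e * a - f * b)
    distrib-re = solve-∀
    distrib-im : ∀ a b c d e f Q → (c + e) * b + (d + f) * a + Q * ((d + f) * b)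
                                   ≡ (c * b + d * a + Q * (d * b)) + (e * b + f * a + Q * (f * b))
    distrib-im = solve-∀
    zero-re : ∀ a b → 0ℤ * a - 0ℤ * b ≡ 0ℤ
    zero-re = solve-∀
    zero-im : ∀ a b Q → 0ℤ * b + 0ℤ * a + Q * (0ℤ * b) ≡ 0ℤ
    zero-im = solve-∀

  open CommutativeSemiring ℛ public
    using (setoid; *-comm; *-assoc; *-identityˡ; *-identityʳ)
  open RawMonoidDefinitions (CommutativeSemiring.+-rawMonoid ℛ) using () renaming (_×_ to _·_)
  open import Algebra.Properties.Semiring.Exp (CommutativeSemiring.semiring ℛ) public using (_^_)

  characteristic : ∀ x → p · x ≋ 𝟘
  characteristic x = mk≋ (p*≈0 (re x) (re-· p)) (p*≈0 (im x) (im-· p))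
    where
    re-· : ∀ n → re (n · x) ≡ + n * re x
    re-· zero = sym (ℤP.*-zeroˡ (re x))
    re-· (suc n) = trans (cong (_+_ (re x)) (re-· n)) (sym (ℤP.suc-* (+ n) (re x)))
    im-· : ∀ n → im (n · x) ≡ + n * im x
    im-· zero = sym (ℤP.*-zeroˡ (im x))
    im-· (suc n) = trans (cong (_+_ (im x)) (im-· n)) (sym (ℤP.suc-* (+ n) (im x)))
    p*≈0 : ∀ a {b} → b ≡ + p * a → b ≈ 0ℤ
    p*≈0 a refl = ≈-trans (≈-reflexive (ℤP.*-comm (+ p) a)) (multiple≈0 a)

  frobenius : ∀ x y → (x ⊕ y) ^ p ≋ x ^ p ⊕ y ^ p
  frobenius = Frobenius.frobenius ℛ p p-prime characteristic

  open IsEquivalence ≋-isEquivalence public using () renaming (refl to ≋-refl; sym to ≋-sym; trans to ≋-trans)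
  open import Algebra.Properties.Semiring.Exp (CommutativeSemiring.semiring ℛ) public
    using (^-congˡ; ^-congʳ; ^-homo-*; ^-assocʳ)
  open import Algebra.Properties.CommutativeSemiring.Exp ℛ public using (^-distrib-*)

  ι-⊗ : ∀ a x → ι a ⊗ x ≋ ⟨ a * re x , a * im x ⟩
  ι-⊗ a x = ≡⇒≋ (scale-re a (re x) (im x)) (scale-im a (re x) (im x) Q)
    where scale-re : ∀ a b c → a * b - 0ℤ * c ≡ a * b
          scale-re = solve-∀
          scale-im : ∀ a b c Q → a * c + 0ℤ * b + Q * (0ℤ * c) ≡ a * c
          scale-im = solve-∀

  ι-cong : ∀ {a b} → a ≈ b → ι a ≋ ι b
  ι-cong a≈b = mk≋ a≈b ≈-refl

  ι-* : ∀ a b → ι a ⊗ ι b ≋ ι (a * b)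
  ι-* a b = ≋-trans (ι-⊗ a (ι b)) (≡⇒≋ refl (ℤP.*-zeroʳ a))

  ι-^ : ∀ a n → ι a ^ n ≋ ι (a ℤ.^ n)
  ι-^ a zero = ≋-refl
  ι-^ a (suc n) = ≋-trans (⊗-cong (≋-refl {ι a}) (ι-^ a n)) (ι-* a (a ℤ.^ n))

  ι-fermat : ∀ a → ι a ^ p ≋ ι a
  ι-fermat a = ≋-trans (ι-^ a p) (ι-cong (fermat a))

  ι-cancelˡ : ∀ {a} x y → ¬ a ≈ 0ℤ → ι a ⊗ x ≋ ι a ⊗ y → x ≋ y
  ι-cancelˡ {a} x y a≉0 ax≋ay = mk≋ (*-cancelˡ a≉0 (re≈ ax≋ay′)) (*-cancelˡ a≉0 (im≈ ax≋ay′))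
    where ax≋ay′ : ⟨ a * re x , a * im x ⟩ ≋ ⟨ a * re y , a * im y ⟩
          ax≋ay′ = ≋-trans (≋-sym (ι-⊗ a x)) (≋-trans ax≋ay (ι-⊗ a y))

  norm : R → ℤ
  norm x = re x * re x + Q * (re x * im x) + im x * im x

  conj : R → R
  conj x = ⟨ re x + Q * im x , - im x ⟩

  norm-⊗ : ∀ x y → norm (x ⊗ y) ≡ norm x * norm y
  norm-⊗ x y = multiplicative (re x) (im x) (re y) (im y) Q
    where
    multiplicative : ∀ a b c d Q →
        (a * c - b * d) * (a * c - b * d) + Q * ((a * c - b * d) * (a * d + b * c + Q * (b * d)))
        + (a * d + b * c + Q * (b * d)) * (a * d + b * c + Q * (b * d))
      ≡ (a * a + Q * (a * b) + b * b) * (c * c + Q * (c * d) + d * d)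
    multiplicative = solve-∀

  norm-cong : ∀ {x y} → x ≋ y → norm x ≈ norm y
  norm-cong (mk≋ a b) = +-cong (+-cong (*-cong a a) (*-cong (≈-refl {Q}) (*-cong a b))) (*-cong b b)

  norm-ι : ∀ c → norm (ι c) ≡ c * c
  norm-ι c = square c Q
    where square : ∀ c Q → c * c + Q * (c * 0ℤ) + 0ℤ * 0ℤ ≡ c * c
          square = solve-∀

  ⊗-conj : ∀ x → x ⊗ conj x ≋ ι (norm x)
  ⊗-conj x = ≡⇒≋ (conj-re (re x) (im x) Q) (conj-im (re x) (im x) Q)
    where conj-re : ∀ a b Q → a * (a + Q * b) - b * (- b) ≡ a * a + Q * (a * b) + b * b
          conj-re = solve-∀
          conj-im : ∀ a b Q → a * (- b) + b * (a + Q * b) + Q * (b * (- b)) ≡ 0ℤ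
          conj-im = solve-∀

  ⊗-cancelˡ : ∀ z x y → ¬ norm z ≈ 0ℤ → z ⊗ x ≋ z ⊗ y → x ≋ y
  ⊗-cancelˡ z x y nz≉0 zx≋zy = ι-cancelˡ x y nz≉0 (begin
    ι (norm z) ⊗ x     ≈⟨ through-conj x ⟩
    conj z ⊗ (z ⊗ x)   ≈⟨ ⊗-cong (≋-refl {conj z}) zx≋zy ⟩
    conj z ⊗ (z ⊗ y)   ≈⟨ through-conj y ⟨
    ι (norm z) ⊗ y ∎)
    where
    open import Relation.Binary.Reasoning.Setoid setoid
    through-conj : ∀ w → ι (norm z) ⊗ w ≋ conj z ⊗ (z ⊗ w)
    through-conj w = begin
      ι (norm z) ⊗ w       ≈⟨ ⊗-cong (≋-sym (⊗-conj z)) (≋-refl {w}) ⟩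
      (z ⊗ conj z) ⊗ w     ≈⟨ ⊗-cong (*-comm z (conj z)) (≋-refl {w}) ⟩
      (conj z ⊗ z) ⊗ w     ≈⟨ *-assoc (conj z) z w ⟩
      conj z ⊗ (z ⊗ w) ∎

  ι-unit-inverse : ∀ {L} x → L ≡ 1ℤ ⊎ L ≡ -1ℤ → ι L ⊗ x ≋ 𝟙 → x ≋ ι L
  ι-unit-inverse {L} x L≡±1 Lx≋1 = begin
    x                    ≈⟨ *-identityˡ x ⟨
    ι 1ℤ ⊗ x            ≡⟨ cong (λ a → ι a ⊗ x) (sym (square≡1 L≡±1)) ⟩
    ι (L * L) ⊗ x       ≈⟨ ⊗-cong (≋-sym (ι-* L L)) (≋-refl {x}) ⟩
    (ι L ⊗ ι L) ⊗ x     ≈⟨ *-assoc (ι L) (ι L) x ⟩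
    ι L ⊗ (ι L ⊗ x)     ≈⟨ ⊗-cong (≋-refl {ι L}) Lx≋1 ⟩
    ι L ⊗ 𝟙             ≈⟨ *-identityʳ (ι L) ⟩
    ι L ∎
    where
    open import Relation.Binary.Reasoning.Setoid setoid
    square≡1 : ∀ {L} → L ≡ 1ℤ ⊎ L ≡ -1ℤ → L * L ≡ 1ℤ
    square≡1 (inj₁ refl) = refl
    square≡1 (inj₂ refl) = refl

module Lucas (p : ℕ) (p-prime : Prime p) (Q : ℤ) where

  open PrimeModulus p p-prime
  open QuadraticRing p p-prime Q
  open import Data.Integer.Base using (_+_; _*_; _-_; -_)

  D T : ℤ
  D = Q * Q - + 4
  T = Q + + 2

  D≡[Q-2]T : D ≡ (Q - + 2) * T
  D≡[Q-2]T = factor Q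
    where factor : ∀ Q → Q * Q - + 4 ≡ (Q - + 2) * (Q + + 2)
          factor = solve-∀

  T≉0 : ¬ D ≈ 0ℤ → ¬ T ≈ 0ℤ
  T≉0 D≉0 T≈0 = D≉0 (≈-trans (≈-reflexive D≡[Q-2]T)
                        (≈-trans (*-cong (≈-refl {Q - + 2}) T≈0) (≈-reflexive (ℤP.*-zeroʳ (Q - + 2)))))

  u : ℕ → ℤ
  u zero = 0ℤ
  u (suc zero) = 1ℤ
  u (suc (suc n)) = Q * u (suc n) - u n

  α^suc : ∀ n → α ^ suc n ≋ ⟨ - u n , u (suc n) ⟩
  α^suc zero = ≡⇒≋ refl (one Q)
    where one : ∀ Q → 0ℤ * 0ℤ + 1ℤ * 1ℤ + Q * (1ℤ * 0ℤ) ≡ 1ℤ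
          one = solve-∀
  α^suc (suc n) = ≋-trans (⊗-cong (≋-refl {α}) (α^suc n)) (≡⇒≋ (shift-re (u n) (u (suc n))) (shift-im (u n) (u (suc n)) Q))
    where shift-re : ∀ a b → 0ℤ * (- a) - 1ℤ * b ≡ - b
          shift-re = solve-∀
          shift-im : ∀ a b Q → 0ℤ * b + 1ℤ * (- a) + Q * (1ℤ * b) ≡ Q * b - a
          shift-im = solve-∀

  im-α^ : ∀ n → im (α ^ n) ≈ u n
  im-α^ zero = ≈-refl
  im-α^ (suc n) = im≈ (α^suc n)

  norm-α^ : ∀ n → norm (α ^ n) ≡ 1ℤ
  norm-α^ zero = one Q
    where one : ∀ Q → 1ℤ * 1ℤ + Q * (1ℤ * 0ℤ) + 0ℤ * 0ℤ ≡ 1ℤ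
          one = solve-∀
  norm-α^ (suc n) = trans (norm-⊗ α (α ^ n)) (trans (cong (norm α *_) (norm-α^ n)) (one Q))
    where one : ∀ Q → (0ℤ * 0ℤ + Q * (0ℤ * 1ℤ) + 1ℤ * 1ℤ) * 1ℤ ≡ 1ℤ
          one = solve-∀

  norm-α^≉0 : ∀ n → ¬ norm (α ^ n) ≈ 0ℤ
  norm-α^≉0 n n≈0 = 1≉0 (≈-trans (≈-reflexive (sym (norm-α^ n))) n≈0)

  α^-inverse : ∀ a b → α ^ a ⊗ α ^ b ≋ 𝟙 → α ^ a ≋ conj (α ^ b)
  α^-inverse a b ab≋1 = ⊗-cancelˡ (α ^ b) (α ^ a) (conj (α ^ b)) (norm-α^≉0 b) (begin
    α ^ b ⊗ α ^ a          ≈⟨ *-comm (α ^ b) (α ^ a) ⟩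
    α ^ a ⊗ α ^ b          ≈⟨ ab≋1 ⟩
    𝟙                       ≈⟨ ι-cong (≈-reflexive (norm-α^ b)) ⟨
    ι (norm (α ^ b))        ≈⟨ ⊗-conj (α ^ b) ⟨
    α ^ b ⊗ conj (α ^ b) ∎)
    where open import Relation.Binary.Reasoning.Setoid setoid

  module IndexOfAppearance (k : ℕ) (1≤k : 1 ℕ.≤ k) (u[k]≈0 : u k ≈ 0ℤ)
                           (minimal : ∀ j → 1 ℕ.≤ j → j ℕ.< k → ¬ u j ≈ 0ℤ) where

    open import Relation.Binary.Reasoning.Setoid setoid

    private instance
      k-nonZero : ℕ.NonZero k
      k-nonZero = ℕ.>-nonZero 1≤k

    c : ℤ
    c = re (α ^ k)

    α^k≋ι[c] : α ^ k ≋ ι c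
    α^k≋ι[c] = mk≋ ≈-refl (≈-trans (im-α^ k) u[k]≈0)

    c²≈1 : c * c ≈ 1ℤ
    c²≈1 = ≈-trans (≈-reflexive (sym (norm-ι c)))
                   (≈-trans (norm-cong (≋-sym α^k≋ι[c])) (≈-reflexive (norm-α^ k)))

    c≈±1 : c ≈ 1ℤ ⊎ c ≈ -1ℤ
    c≈±1 = square≈1 c c²≈1

    c≉0 : ¬ c ≈ 0ℤ
    c≉0 c≈0 = 1≉0 (≈-trans (≈-sym c²≈1) (*-cong c≈0 c≈0))

    c^even≈1 : ∀ j → c ℤ.^ (j ℕ.+ j) ≈ 1ℤ
    c^even≈1 j = ≈-trans (≈-reflexive (sym (square-^ c j)))
                         (≈-trans (^-cong j c²≈1) (≈-reflexive (ℤP.^-zeroˡ j)))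

    α^[k*M]≋ι[c^M] : ∀ M → α ^ (k ℕ.* M) ≋ ι (c ℤ.^ M)
    α^[k*M]≋ι[c^M] M = begin
      α ^ (k ℕ.* M)   ≈⟨ ^-assocʳ α k M ⟨
      (α ^ k) ^ M     ≈⟨ ^-congˡ M α^k≋ι[c] ⟩
      ι c ^ M         ≈⟨ ι-^ c M ⟩
      ι (c ℤ.^ M) ∎

    k∣zeros : ∀ n → u n ≈ 0ℤ → k ℕD.∣ n
    k∣zeros n u[n]≈0 with n ℕDM.% k ℕ.≟ 0
    ... | yes r≡0 = ℕD.m%n≡0⇒n∣m n k r≡0
    ... | no r≢0 = ⊥-elim (minimal r (ℕP.n≢0⇒n>0 r≢0) (ℕDM.m%n<n n k) u[r]≈0)
      where
      r q : ℕ
      r = n ℕDM.% k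
      q = n ℕDM./ k
      α^n≋c^q⊗α^r : α ^ n ≋ ι (c ℤ.^ q) ⊗ α ^ r
      α^n≋c^q⊗α^r = begin
        α ^ n                  ≈⟨ ^-congʳ α (trans (ℕDM.m≡m%n+[m/n]*n n k) (cong (r ℕ.+_) (ℕP.*-comm q k))) ⟩
        α ^ (r ℕ.+ k ℕ.* q)   ≈⟨ ^-homo-* α r (k ℕ.* q) ⟩
        α ^ r ⊗ α ^ (k ℕ.* q) ≈⟨ ⊗-cong (≋-refl {α ^ r}) (α^[k*M]≋ι[c^M] q) ⟩
        α ^ r ⊗ ι (c ℤ.^ q)   ≈⟨ *-comm (α ^ r) (ι (c ℤ.^ q)) ⟩
        ι (c ℤ.^ q) ⊗ α ^ r ∎
      u[r]≈0 : u r ≈ 0ℤ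
      u[r]≈0 = *-cancelˡ (^-≉0 q c≉0) (≈-trans (*-cong (≈-refl {c ℤ.^ q}) (≈-sym (im-α^ r)))
                 (≈-trans (≈-sym (im≈ (≋-trans α^n≋c^q⊗α^r (ι-⊗ (c ℤ.^ q) (α ^ r)))))
                 (≈-trans (im-α^ n) (≈-trans u[n]≈0 (≈-reflexive (sym (ℤP.*-zeroʳ (c ℤ.^ q))))))))

    -- If α^k = 1 then α^⌈k/2⌉ and α^⌊k/2⌋ are conjugate; k even would give an earlier zero u (k/2) = 0.
    c≈1⇒W-zero : ¬ + 2 ≈ 0ℤ → c ≈ 1ℤ → ∃ λ j → u (suc j) + u j ≈ 0ℤ
    c≈1⇒W-zero 2≉0 c≈1 = halves k (evenOdd k) refl
      where
      α^k≋𝟙 : α ^ k ≋ 𝟙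
      α^k≋𝟙 = ≋-trans α^k≋ι[c] (ι-cong c≈1)
      conjugate-halves : ∀ a b → a ℕ.+ b ≡ k → α ^ a ≋ conj (α ^ b)
      conjugate-halves a b a+b≡k = α^-inverse a b (≋-trans (≋-sym (^-homo-* α a b))
                                     (≋-trans (^-congʳ α a+b≡k) α^k≋𝟙))
      halves : ∀ n → EvenOdd n → n ≡ k → ∃ λ j → u (suc j) + u j ≈ 0ℤ
      halves _ (odd j) k≡ = j , ≈-trans (+-cong (≈-sym (im-α^ (suc j))) (≈-sym (im-α^ j)))
        (≈-trans (+-cong (im≈ (conjugate-halves (suc j) j k≡)) (≈-refl {im (α ^ j)}))
                 (≈-reflexive (ℤP.+-inverseˡ (im (α ^ j)))))
      halves _ (even zero) k≡ = ⊥-elim (ℕP.<-irrefl k≡ 1≤k)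
      halves _ (even j@(suc _)) k≡ =
        ⊥-elim (minimal j (ℕ.s≤s ℕ.z≤n) (subst (j ℕ.<_) k≡ (ℕP.m<m+n j (ℕ.s≤s ℕ.z≤n))) u[j]≈0)
        where
        u[j]≈0 : u j ≈ 0ℤ
        u[j]≈0 = *-cancelˡ 2≉0 (≈-trans (≈-reflexive (double (u j)))
          (≈-trans (+-cong (≈-sym (im-α^ j)) (≈-sym (im-α^ j)))
          (≈-trans (+-cong (im≈ (conjugate-halves j j k≡)) (≈-refl {im (α ^ j)}))
                   (≈-reflexive (trans (ℤP.+-inverseˡ (im (α ^ j))) (sym (ℤP.*-zeroʳ (+ 2))))))))
          where double : ∀ x → + 2 * x ≡ x + x
                double = solve-∀

module QuadraticCharacter (p : ℕ) (p-prime : Prime p) (m : ℕ) (p≡1+2m : p ≡ suc (m ℕ.+ m)) where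

  open PrimeModulus p p-prime
  open Euler m p≡1+2m
  open import Data.Integer.Base using (_^_)

  euler-criterion : ∀ {a L} → IsLegendre a L → ¬ a ≈ 0ℤ → a ^ m ≈ L
  euler-criterion (divisible a≈0) a≉0 = ⊥-elim (a≉0 a≈0)
  euler-criterion (residue a≉0 □) _ = euler-square □ a≉0
  euler-criterion (nonresidue a≉0 ¬□) _ = euler-nonsquare ¬□ a≉0

  2≉0 : ¬ + 2 ≈ 0ℤ
  2≉0 = small≉0 (ℕ.s≤s ℕ.z≤n) (2<p m p≡1+2m)
    where 2<p : ∀ j → p ≡ suc (j ℕ.+ j) → 2 ℕ.< p
          2<p zero p≡1 = ⊥-elim (ℕP.<-irrefl (sym p≡1) 1<p)
          2<p (suc j) refl = ℕ.s≤s (ℕ.s≤s (subst (1 ℕ.≤_) (sym (ℕP.+-suc j j)) (ℕ.s≤s ℕ.z≤n)))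

  -1≉1 : ¬ -1ℤ ≈ 1ℤ
  -1≉1 -1≈1 = 2≉0 (-cong (≈-refl {1ℤ}) -1≈1)

module LucasEuler (p : ℕ) (p-prime : Prime p) (m : ℕ) (p≡1+2m : p ≡ suc (m ℕ.+ m)) (Q : ℤ) where

  open PrimeModulus p p-prime
  open QuadraticCharacter p p-prime m p≡1+2m
  open QuadraticRing p p-prime Q
  open Lucas p p-prime Q using (D; T; T≉0)
  open import Data.Integer.Base using (_+_; _*_; _-_; -_)
  open import Relation.Binary.Reasoning.Setoid setoid
  open import Algebra.Properties.CommutativeSemigroup (CommutativeSemiring.*-commutativeSemigroup ℛ)
    using (x∙yz≈y∙xz)

  ^p≋ : ∀ x → x ^ p ≋ x ⊗ (x ⊗ x) ^ m
  ^p≋ x = begin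
    x ^ p                  ≈⟨ ^-congʳ x p≡1+2m ⟩
    x ⊗ x ^ (m ℕ.+ m)     ≈⟨ ⊗-cong (≋-refl {x}) (^-homo-* x m m) ⟩
    x ⊗ (x ^ m ⊗ x ^ m)   ≈⟨ ⊗-cong (≋-refl {x}) (^-distrib-* x x m) ⟨
    x ⊗ (x ⊗ x) ^ m ∎

  -- s = 2α − Q is a square root of D; w = 1 + α satisfies w² = Tα and w w̄ = T; β = Q − α = α⁻¹.
  s w w̄ β : R
  s = ⟨ - Q , + 2 ⟩
  w = ⟨ 1ℤ , 1ℤ ⟩
  w̄ = ⟨ 1ℤ + Q , -1ℤ ⟩
  β = ⟨ Q , -1ℤ ⟩

  s⊗s≋ι[D] : s ⊗ s ≋ ι D
  s⊗s≋ι[D] = ≡⇒≋ (square-re Q) (square-im Q)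
    where square-re : ∀ Q → (- Q) * (- Q) - + 2 * + 2 ≡ Q * Q - + 4
          square-re = solve-∀
          square-im : ∀ Q → (- Q) * + 2 + + 2 * (- Q) + Q * (+ 2 * + 2) ≡ 0ℤ
          square-im = solve-∀

  w⊗w≋ι[T]⊗α : w ⊗ w ≋ ι T ⊗ α
  w⊗w≋ι[T]⊗α = ≡⇒≋ (square-re Q) (square-im Q)
    where square-re : ∀ Q → 1ℤ * 1ℤ - 1ℤ * 1ℤ ≡ (Q + + 2) * 0ℤ - 0ℤ * 1ℤ
          square-re = solve-∀
          square-im : ∀ Q → 1ℤ * 1ℤ + 1ℤ * 1ℤ + Q * (1ℤ * 1ℤ) ≡ (Q + + 2) * 1ℤ + 0ℤ * 0ℤ + Q * (0ℤ * 1ℤ)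
          square-im = solve-∀

  w⊗w̄≋ι[T] : w ⊗ w̄ ≋ ι T
  w⊗w̄≋ι[T] = ≡⇒≋ (norm-re Q) (norm-im Q)
    where norm-re : ∀ Q → 1ℤ * (1ℤ + Q) - 1ℤ * -1ℤ ≡ Q + + 2
          norm-re = solve-∀
          norm-im : ∀ Q → 1ℤ * -1ℤ + 1ℤ * (1ℤ + Q) + Q * (1ℤ * -1ℤ) ≡ 0ℤ
          norm-im = solve-∀

  norm-w : norm w ≡ T
  norm-w = norm-1+α Q
    where norm-1+α : ∀ Q → 1ℤ * 1ℤ + Q * (1ℤ * 1ℤ) + 1ℤ * 1ℤ ≡ Q + + 2
          norm-1+α = solve-∀

  module _ {LD LT} (D≉0 : ¬ D ≈ 0ℤ) (D-legendre : IsLegendre D LD) (T-legendre : IsLegendre T LT) where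

    s^p≋LD⊗s : s ^ p ≋ ⟨ LD * (- Q) , LD * + 2 ⟩
    s^p≋LD⊗s = begin
      s ^ p               ≈⟨ ^p≋ s ⟩
      s ⊗ (s ⊗ s) ^ m     ≈⟨ ⊗-cong (≋-refl {s}) (^-congˡ m s⊗s≋ι[D]) ⟩
      s ⊗ ι D ^ m         ≈⟨ ⊗-cong (≋-refl {s}) (ι-^ D m) ⟩
      s ⊗ ι (D ℤ.^ m)     ≈⟨ ⊗-cong (≋-refl {s}) (ι-cong (euler-criterion D-legendre D≉0)) ⟩
      s ⊗ ι LD            ≈⟨ *-comm s (ι LD) ⟩
      ι LD ⊗ s            ≈⟨ ι-⊗ LD s ⟩
      ⟨ LD * (- Q) , LD * + 2 ⟩ ∎

    2α^p≋Q+LD⊗s : ι (+ 2) ⊗ α ^ p ≋ ⟨ Q + LD * (- Q) , 0ℤ + LD * + 2 ⟩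
    2α^p≋Q+LD⊗s = begin
      ι (+ 2) ⊗ α ^ p          ≈⟨ ⊗-cong (ι-fermat (+ 2)) (≋-refl {α ^ p}) ⟨
      ι (+ 2) ^ p ⊗ α ^ p      ≈⟨ ^-distrib-* (ι (+ 2)) α p ⟨
      (ι (+ 2) ⊗ α) ^ p        ≈⟨ ^-congˡ p (≡⇒≋ (two-α-re Q) (two-α-im Q)) ⟩
      (ι Q ⊕ s) ^ p            ≈⟨ frobenius (ι Q) s ⟩
      ι Q ^ p ⊕ s ^ p          ≈⟨ ⊕-cong (ι-fermat Q) s^p≋LD⊗s ⟩
      ⟨ Q + LD * (- Q) , 0ℤ + LD * + 2 ⟩ ∎
      where two-α-re : ∀ Q → + 2 * 0ℤ - 0ℤ * 1ℤ ≡ Q + - Q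
            two-α-re = solve-∀
            two-α-im : ∀ Q → + 2 * 1ℤ + 0ℤ * 0ℤ + Q * (0ℤ * 1ℤ) ≡ 0ℤ + + 2
            two-α-im = solve-∀

    w^p≋w⊗LT⊗α^m : w ^ p ≋ w ⊗ (ι LT ⊗ α ^ m)
    w^p≋w⊗LT⊗α^m = begin
      w ^ p                        ≈⟨ ^p≋ w ⟩
      w ⊗ (w ⊗ w) ^ m              ≈⟨ ⊗-cong (≋-refl {w}) (^-congˡ m w⊗w≋ι[T]⊗α) ⟩
      w ⊗ (ι T ⊗ α) ^ m            ≈⟨ ⊗-cong (≋-refl {w}) (^-distrib-* (ι T) α m) ⟩
      w ⊗ (ι T ^ m ⊗ α ^ m)        ≈⟨ ⊗-cong (≋-refl {w}) (⊗-cong (ι-^ T m) (≋-refl {α ^ m})) ⟩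
      w ⊗ (ι (T ℤ.^ m) ⊗ α ^ m)    ≈⟨ ⊗-cong (≋-refl {w}) (⊗-cong (ι-cong (euler-criterion T-legendre (T≉0 D≉0))) (≋-refl {α ^ m})) ⟩
      w ⊗ (ι LT ⊗ α ^ m) ∎

    w^p≋1+α^p : w ^ p ≋ 𝟙 ⊕ α ^ p
    w^p≋1+α^p = ≋-trans (frobenius 𝟙 α) (⊕-cong (ι-fermat 1ℤ) (≋-refl {α ^ p}))

    α^p≋α : LD ≡ 1ℤ → α ^ p ≋ α
    α^p≋α refl = ι-cancelˡ (α ^ p) α 2≉0 (≋-trans 2α^p≋Q+LD⊗s (≡⇒≋ (cancel-re Q) (cancel-im Q)))
      where cancel-re : ∀ Q → Q + 1ℤ * (- Q) ≡ + 2 * 0ℤ - 0ℤ * 1ℤ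
            cancel-re = solve-∀
            cancel-im : ∀ Q → 0ℤ + 1ℤ * + 2 ≡ + 2 * 1ℤ + 0ℤ * 0ℤ + Q * (0ℤ * 1ℤ)
            cancel-im = solve-∀

    α^p≋β : LD ≡ -1ℤ → α ^ p ≋ β
    α^p≋β refl = ι-cancelˡ (α ^ p) β 2≉0 (≋-trans 2α^p≋Q+LD⊗s (≡⇒≋ (cancel-re Q) (cancel-im Q)))
      where cancel-re : ∀ Q → Q + -1ℤ * (- Q) ≡ + 2 * Q - 0ℤ * -1ℤ
            cancel-re = solve-∀
            cancel-im : ∀ Q → 0ℤ + -1ℤ * + 2 ≡ + 2 * -1ℤ + 0ℤ * Q + Q * (0ℤ * -1ℤ)
            cancel-im = solve-∀

    LT⊗α^m≋1 : LD ≡ 1ℤ → ι LT ⊗ α ^ m ≋ 𝟙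
    LT⊗α^m≋1 LD≡1 = ⊗-cancelˡ w (ι LT ⊗ α ^ m) 𝟙 norm-w≉0 (begin
      w ⊗ (ι LT ⊗ α ^ m)   ≈⟨ w^p≋w⊗LT⊗α^m ⟨
      w ^ p                ≈⟨ w^p≋1+α^p ⟩
      𝟙 ⊕ α ^ p            ≈⟨ ⊕-cong (≋-refl {𝟙}) (α^p≋α LD≡1) ⟩
      w                    ≈⟨ *-identityʳ w ⟨
      w ⊗ 𝟙 ∎)
      where norm-w≉0 : ¬ norm w ≈ 0ℤ
            norm-w≉0 norm≈0 = T≉0 D≉0 (≈-trans (≈-reflexive (sym norm-w)) norm≈0)

    LT⊗α^[1+m]≋1 : LD ≡ -1ℤ → ι LT ⊗ α ^ suc m ≋ 𝟙
    LT⊗α^[1+m]≋1 LD≡-1 = ι-cancelˡ (ι LT ⊗ α ^ suc m) 𝟙 (T≉0 D≉0) (begin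
      ι T ⊗ (ι LT ⊗ (α ⊗ α ^ m))   ≈⟨ ⊗-cong (≋-refl {ι T}) (x∙yz≈y∙xz (ι LT) α (α ^ m)) ⟩
      ι T ⊗ (α ⊗ (ι LT ⊗ α ^ m))   ≈⟨ *-assoc (ι T) α (ι LT ⊗ α ^ m) ⟨
      (ι T ⊗ α) ⊗ (ι LT ⊗ α ^ m)   ≈⟨ ⊗-cong (≋-sym w⊗w≋ι[T]⊗α) (≋-refl {ι LT ⊗ α ^ m}) ⟩
      (w ⊗ w) ⊗ (ι LT ⊗ α ^ m)     ≈⟨ *-assoc w w (ι LT ⊗ α ^ m) ⟩
      w ⊗ (w ⊗ (ι LT ⊗ α ^ m))     ≈⟨ ⊗-cong (≋-refl {w}) (≋-sym w^p≋w⊗LT⊗α^m) ⟩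
      w ⊗ w ^ p                    ≈⟨ ⊗-cong (≋-refl {w}) (≋-trans w^p≋1+α^p (⊕-cong (≋-refl {𝟙}) (α^p≋β LD≡-1))) ⟩
      w ⊗ w̄                        ≈⟨ w⊗w̄≋ι[T] ⟩
      ι T                          ≈⟨ *-identityʳ (ι T) ⟨
      ι T ⊗ 𝟙 ∎)

    private
      LT≡±1 : LT ≡ 1ℤ ⊎ LT ≡ -1ℤ
      LT≡±1 = legendre-unit T-legendre (T≉0 D≉0)

    lucas-euler : Σ ℕ λ h → (+ p - LD ≡ + (h ℕ.+ h)) × (α ^ h ≋ ι LT)
    lucas-euler with legendre-unit D-legendre D≉0
    ... | inj₁ LD≡1@refl = m , cong (λ n → + n - 1ℤ) p≡1+2m , ι-unit-inverse (α ^ m) LT≡±1 (LT⊗α^m≋1 LD≡1)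
    ... | inj₂ LD≡-1@refl = suc m , cong +_ p+1≡2[1+m] , ι-unit-inverse (α ^ suc m) LT≡±1 (LT⊗α^[1+m]≋1 LD≡-1)
      where p+1≡2[1+m] : p ℕ.+ 1 ≡ suc m ℕ.+ suc m
            p+1≡2[1+m] = trans (cong (ℕ._+ 1) p≡1+2m) (regroup m)
              where regroup : ∀ m → suc (m ℕ.+ m) ℕ.+ 1 ≡ suc m ℕ.+ suc m
                    regroup = ℕS.solve-∀

module Degenerate (p : ℕ) (p-prime : Prime p) (Q : ℤ) where

  open PrimeModulus p p-prime
  open Lucas p p-prime Q using (u; D; T; D≡[Q-2]T)
  open import Data.Integer.Base using (_+_; _*_; _-_; -_; _^_)

  Q≈±2 : D ≈ 0ℤ → ∃ λ ε → (ε ≡ 1ℤ ⊎ ε ≡ -1ℤ) × Q ≈ + 2 * ε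
  Q≈±2 D≈0 = [ (λ Q-2≈0 → 1ℤ , inj₁ refl , -≈0⇒≈ Q (+ 2) Q-2≈0)
             , (λ Q+2≈0 → -1ℤ , inj₂ refl , -≈0⇒≈ Q (- + 2) Q+2≈0) ]′
               (≈0-product (Q - + 2) T (≈-trans (≈-reflexive (sym D≡[Q-2]T)) D≈0))

  T-not-nonresidue : ∀ {LT} → D ≈ 0ℤ → IsLegendre T LT → LT ≢ -1ℤ
  T-not-nonresidue D≈0 (nonresidue T≉0 T∉□) refl = contradiction (Q≈±2 D≈0)
    where contradiction : (∃ λ ε → (ε ≡ 1ℤ ⊎ ε ≡ -1ℤ) × Q ≈ + 2 * ε) → ⊥
          contradiction (_ , inj₁ refl , Q≈2) = T∉□ (+ 2 , ≈-sym (+-cong Q≈2 (≈-refl {+ 2})))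
          contradiction (_ , inj₂ refl , Q≈-2) = T≉0 (+-cong Q≈-2 (≈-refl {+ 2}))

  module _ {ε} (ε≡±1 : ε ≡ 1ℤ ⊎ ε ≡ -1ℤ) (Q≈2ε : Q ≈ + 2 * ε) where

    u≈n·ε^[1+n] : ∀ n → u n ≈ + n * ε ^ suc n × u (suc n) ≈ + suc n * ε ^ suc (suc n)
    u≈n·ε^[1+n] zero = ≈-reflexive (sym (ℤP.*-zeroˡ (ε ^ 1))) , ≈-reflexive (ε·ε≡1 ε≡±1)
      where ε·ε≡1 : ε ≡ 1ℤ ⊎ ε ≡ -1ℤ → 1ℤ ≡ + 1 * (ε * (ε * 1ℤ))
            ε·ε≡1 (inj₁ refl) = refl
            ε·ε≡1 (inj₂ refl) = refl
    u≈n·ε^[1+n] (suc n) =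
      let (u[n]≈ , u[1+n]≈) = u≈n·ε^[1+n] n in
      u[1+n]≈ , ≈-trans (-cong (*-cong Q≈2ε u[1+n]≈) u[n]≈) (≈-reflexive (step ε≡±1 (+ n) (ε ^ suc n)))
      where
      step : ε ≡ 1ℤ ⊎ ε ≡ -1ℤ → ∀ N t → + 2 * ε * ((1ℤ + N) * (ε * t)) - N * t ≡ (+ 2 + N) * (ε * (ε * t))
      step (inj₁ refl) = solve-∀
      step (inj₂ refl) = solve-∀

    ε≉0 : ¬ ε ≈ 0ℤ
    ε≉0 = unit≉0 ε≡±1
      where unit≉0 : ∀ {ε} → ε ≡ 1ℤ ⊎ ε ≡ -1ℤ → ¬ ε ≈ 0ℤ
            unit≉0 (inj₁ refl) = 1≉0
            unit≉0 (inj₂ refl) = 1≉0 ∘ -‿cong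

    u≈0⇒p∣n : ∀ n → u n ≈ 0ℤ → p ℕD.∣ n
    u≈0⇒p∣n n u[n]≈0 = proj₁ ≈0⇔∣ (*-cancelˡ (^-≉0 (suc n) ε≉0)
      (≈-trans (≈-reflexive (ℤP.*-comm (ε ^ suc n) (+ n)))
      (≈-trans (≈-sym (proj₁ (u≈n·ε^[1+n] n)))
      (≈-trans u[n]≈0 (≈-reflexive (sym (ℤP.*-zeroʳ (ε ^ suc n))))))))

    u[p]≈0 : u p ≈ 0ℤ
    u[p]≈0 = ≈-trans (proj₁ (u≈n·ε^[1+n] p))
             (≈-trans (*-cong (proj₂ (≈0⇔∣ {+ p}) (ℕD.∣-refl {p})) (≈-refl {ε ^ suc p})) (≈-reflexive (ℤP.*-zeroˡ (ε ^ suc p))))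

    index≡p : ∀ k → 1 ℕ.≤ k → u k ≈ 0ℤ → (∀ j → 1 ℕ.≤ j → j ℕ.< k → ¬ u j ≈ 0ℤ) → k ≡ p
    index≡p k 1≤k u[k]≈0 minimal = ℕP.≤-antisym k≤p (ℕD.∣⇒≤ {{ℕ.>-nonZero 1≤k}} (u≈0⇒p∣n k u[k]≈0))
      where k≤p : k ℕ.≤ p
            k≤p with k ℕP.≤? p
            ... | yes k≤p = k≤p
            ... | no k≰p = ⊥-elim (minimal p (ℕP.<⇒≤ 1<p) (ℕP.≰⇒> k≰p) u[p]≈0)

  D≈0⇒index≡p : D ≈ 0ℤ → ∀ k → 1 ℕ.≤ k → u k ≈ 0ℤ → (∀ j → 1 ℕ.≤ j → j ℕ.< k → ¬ u j ≈ 0ℤ) → k ≡ p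
  D≈0⇒index≡p D≈0 = let (_ , ε≡±1 , Q≈2ε) = Q≈±2 D≈0 in index≡p ε≡±1 Q≈2ε

module IndexOfAppearanceTheorems (p : ℕ) (p-prime : Prime p) (m : ℕ) (p≡1+2m : p ≡ suc (m ℕ.+ m)) (Q : ℤ) where

  open PrimeModulus p p-prime
  open QuadraticCharacter p p-prime m p≡1+2m
  open QuadraticRing p p-prime Q
  open Lucas p p-prime Q
  open LucasEuler p p-prime m p≡1+2m Q
  open import Data.Integer.Base using (_+_; _*_; _-_; -_)

  module OfIndex (k : ℕ) (1≤k : 1 ℕ.≤ k) (u[k]≈0 : u k ≈ 0ℤ) (minimal : ∀ j → 1 ℕ.≤ j → j ℕ.< k → ¬ u j ≈ 0ℤ)
           {LD LT : ℤ} (D-legendre : IsLegendre D LD) (T-legendre : IsLegendre T LT) where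

    open IndexOfAppearance k 1≤k u[k]≈0 minimal

    p-LD≡2k·M : ¬ D ≈ 0ℤ → ∃ λ M → (+ p - LD ≡ + (2 ℕ.* k) * + M) × c ℤ.^ M ≈ LT
    p-LD≡2k·M D≉0 with lucas-euler D≉0 D-legendre T-legendre
    ... | h , p-LD≡2h , α^h≋LT with k∣zeros h (≈-trans (≈-sym (im-α^ h)) (im≈ α^h≋LT))
    ... | ℕD.divides M refl = M , trans p-LD≡2h (trans (cong +_ (regroup M k)) (ℤP.pos-* (2 ℕ.* k) M))
                                , re≈ (≋-trans (≋-sym (α^[k*M]≋ι[c^M] M)) (≋-trans (^-congʳ α (ℕP.*-comm k M)) α^h≋LT))
      where regroup : ∀ M k → M ℕ.* k ℕ.+ M ℕ.* k ≡ 2 ℕ.* k ℕ.* M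
            regroup = ℕS.solve-∀

    private
      instance
        2k-nonZero : ℕ.NonZero (2 ℕ.* k)
        2k-nonZero = ℕ.>-nonZero (ℕP.≤-trans 1≤k (ℕP.m≤m+n k _))

      p-odd : ¬ 2 ℕD.∣ p
      p-odd = subst (λ n → ¬ 2 ℕD.∣ n) (sym p≡1+2m) (2∤1+2m m)

      degenerate-k≡p : D ≈ 0ℤ → k ≡ p
      degenerate-k≡p D≈0 = Degenerate.D≈0⇒index≡p p p-prime Q D≈0 k 1≤k u[k]≈0 minimal

      j*2≡j+j : ∀ j → j ℕ.* 2 ≡ j ℕ.+ j
      j*2≡j+j = ℕS.solve-∀

    2k∣p-LD : LD ≢ 0ℤ → + (2 ℕ.* k) ℤD.∣ + p - LD
    2k∣p-LD LD≢0 with legendre-cases D-legendre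
    ... | inj₁ (_ , LD≡0) = ⊥-elim (LD≢0 LD≡0)
    ... | inj₂ D≉0 with p-LD≡2k·M D≉0
    ...   | M , p-LD≡2kM , _ = ℤS.∣⇒∣ᵤ (ℤS.divides (+ M) (trans p-LD≡2kM (ℤP.*-comm (+ (2 ℕ.* k)) (+ M))))

    LT≡-1⇒odd-quotient : LT ≡ -1ℤ → ∃ λ m′ → (+ p - LD ≡ + (2 ℕ.* k) * m′) × OddInt m′
    LT≡-1⇒odd-quotient LT≡-1 with legendre-cases D-legendre
    ... | inj₁ (D≈0 , _) = ⊥-elim (Degenerate.T-not-nonresidue p p-prime Q D≈0 T-legendre LT≡-1)
    ... | inj₂ D≉0 with p-LD≡2k·M D≉0
    ...   | M , p-LD≡2kM , c^M≈LT = + M , p-LD≡2kM , M-odd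
      where
      M-odd : OddInt (+ M)
      M-odd (ℕD.divides j M≡j*2) = -1≉1 (≈-trans (≈-reflexive (sym LT≡-1)) (≈-trans (≈-sym c^M≈LT)
        (subst (λ n → c ℤ.^ n ≈ 1ℤ) (sym (trans M≡j*2 (j*2≡j+j j))) (c^even≈1 j))))

    odd-quotient⇒LT≡-1 : ¬ (∃ λ j → u (suc j) + u j ≈ 0ℤ) →
                         (∃ λ m′ → (+ p - LD ≡ + (2 ℕ.* k) * m′) × OddInt m′) → LT ≡ -1ℤ
    odd-quotient⇒LT≡-1 ¬Π₀ (m′ , p-LD≡2km′ , m′-odd) with legendre-cases D-legendre
    ... | inj₁ (D≈0 , refl) = ⊥-elim (p-odd (ℤS.∣⇒∣ᵤ (ℤS.divides (+ p * m′) p≡[pm′]2)))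
      where
      open ≡-Reasoning
      p≡[pm′]2 : + p ≡ (+ p * m′) * + 2
      p≡[pm′]2 = begin
        + p                  ≡⟨ ℤP.+-identityʳ (+ p) ⟨
        + p - 0ℤ             ≡⟨ p-LD≡2km′ ⟩
        + (2 ℕ.* k) * m′     ≡⟨ cong (λ n → + (2 ℕ.* n) * m′) (degenerate-k≡p D≈0) ⟩
        + (2 ℕ.* p) * m′     ≡⟨ cong (_* m′) (ℤP.pos-* 2 p) ⟩
        (+ 2 * + p) * m′     ≡⟨ rearrange (+ p) m′ ⟩
        (+ p * m′) * + 2 ∎
        where rearrange : ∀ p m → (+ 2 * p) * m ≡ (p * m) * + 2
              rearrange = solve-∀
    ... | inj₂ D≉0 with p-LD≡2k·M D≉0
    ...   | M , p-LD≡2kM , c^M≈LT with evenOdd M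
    ...     | even j = ⊥-elim (m′-odd (subst (+ 2 ℤD.∣_) (sym m′≡M) (ℕD.divides j (sym (j*2≡j+j j)))))
      where m′≡M : m′ ≡ + (j ℕ.+ j)
            m′≡M = ℤP.*-cancelˡ-≡ (+ (2 ℕ.* k)) m′ (+ (j ℕ.+ j)) (trans (sym p-LD≡2km′) p-LD≡2kM)
    ...     | odd j = [ (λ c≈1 → ⊥-elim (¬Π₀ (c≈1⇒W-zero 2≉0 c≈1))) , LT≡-1 ]′ c≈±1
      where
      LT≈c : LT ≈ c
      LT≈c = ≈-trans (≈-sym c^M≈LT) (≈-trans (*-cong (≈-refl {c}) (c^even≈1 j)) (≈-reflexive (ℤP.*-identityʳ c)))
      LT≡-1 : c ≈ -1ℤ → LT ≡ -1ℤ
      LT≡-1 c≈-1 = [ (λ LT≡1 → ⊥-elim (-1≉1 (≈-trans (≈-sym c≈-1) (≈-trans (≈-sym LT≈c) (≈-reflexive LT≡1))))) , id ]′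
                     (legendre-unit T-legendre (T≉0 D≉0))

    p-LD≡2[mod4]⇒k-odd : (∃ λ t → + p - LD ≡ + 4 * t + + 2) → ¬ 2 ℕD.∣ k
    p-LD≡2[mod4]⇒k-odd (t , p-LD≡4t+2) 2∣k@(ℕD.divides q k≡q*2) with legendre-cases D-legendre
    ... | inj₁ (D≈0 , _) = p-odd (subst (2 ℕD.∣_) (degenerate-k≡p D≈0) 2∣k)
    ... | inj₂ D≉0 with p-LD≡2k·M D≉0
    ...   | M , p-LD≡2kM , _ = 4x≢4t+2 (+ (q ℕ.* M)) t (trans (sym 2kM≡4qM) (trans (sym p-LD≡2kM) p-LD≡4t+2))
      where
      regroup : ∀ q M → 2 ℕ.* (q ℕ.* 2) ℕ.* M ≡ 4 ℕ.* (q ℕ.* M)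
      regroup = ℕS.solve-∀
      2kM≡4qM : + (2 ℕ.* k) * + M ≡ + 4 * + (q ℕ.* M)
      2kM≡4qM = trans (sym (ℤP.pos-* (2 ℕ.* k) M))
                  (trans (cong +_ (trans (cong (λ n → 2 ℕ.* n ℕ.* M) k≡q*2) (regroup q M))) (ℤP.pos-* 4 (q ℕ.* M)))

    p-LD≡2r⇒k≡r : ∀ r → Prime r → + p - LD ≡ + (2 ℕ.* r) → k ≡ r
    p-LD≡2r⇒k≡r r r-prime p-LD≡2r with legendre-cases D-legendre
    ... | inj₁ (_ , refl) =
      ⊥-elim (p-odd (ℕD.divides r (trans (ℤP.+-injective (trans (sym (ℤP.+-identityʳ (+ p))) p-LD≡2r)) (ℕP.*-comm 2 r))))
    ... | inj₂ D≉0 with p-LD≡2k·M D≉0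
    ...   | M , p-LD≡2kM , _ =
      [ (λ k≡1 → ⊥-elim (1≉0 (subst (λ n → u n ≈ 0ℤ) k≡1 u[k]≈0))) , id ]′
        (prime⇒irreducible r-prime (ℕD.divides M (trans (sym kM≡r) (ℕP.*-comm k M))))
      where
      regroup : ∀ k M → 2 ℕ.* k ℕ.* M ≡ 2 ℕ.* (k ℕ.* M)
      regroup = ℕS.solve-∀
      kM≡r : k ℕ.* M ≡ r
      kM≡r = ℕP.*-cancelˡ-≡ (k ℕ.* M) r 2
               (trans (sym (regroup k M)) (ℤP.+-injective (trans (ℤP.pos-* (2 ℕ.* k) M) (trans (sym p-LD≡2kM) p-LD≡2r))))

    LD≡0⇒k≡p : LD ≡ 0ℤ → k ≡ p
    LD≡0⇒k≡p LD≡0 with legendre-cases D-legendre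
    ... | inj₁ (D≈0 , _) = degenerate-k≡p D≈0
    ... | inj₂ D≉0 with legendre-unit D-legendre D≉0 | LD≡0
    ...   | inj₁ refl | ()
    ...   | inj₂ refl | ()

module RationalReduction (p : ℕ) (p-prime : Prime p) where

  open PrimeModulus p p-prime
  open import Data.Integer.Base using (_+_; _*_; _-_; -_; _^_)

  infix 4 _↦_
  record _↦_ (x : ℚ) (r : ℤ) : Set where
    constructor reduces
    field
      ↧≉0 : ¬ ↧ x ≈ 0ℤ
      ↥≈ : ↥ x ≈ r * ↧ x

  -- Normalisation divides the unreduced numerator a and denominator b by their gcd g; as b is a
  -- unit mod p, so is g.
  ↦-fraction : ∀ x g {a b} r → ↥ x * g ≡ a → ↧ x * g ≡ b → ¬ b ≈ 0ℤ → a ≈ r * b → x ↦ r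
  ↦-fraction x g {a} {b} r ↥x·g≡a ↧x·g≡b b≉0 a≈rb = reduces ↧x≉0 (*-cancelˡ g≉0 (begin
    g * ↥ x         ≡⟨ trans (ℤP.*-comm g (↥ x)) ↥x·g≡a ⟩
    a               ≈⟨ a≈rb ⟩
    r * b           ≡⟨ cong (r *_) ↧x·g≡b ⟨
    r * (↧ x * g)   ≡⟨ rearrange r (↧ x) g ⟩
    g * (r * ↧ x) ∎))
    where
    open import Relation.Binary.Reasoning.Setoid ≈-setoid
    rearrange : ∀ r d g → r * (d * g) ≡ g * (r * d)
    rearrange = solve-∀
    ↧x≉0 : ¬ ↧ x ≈ 0ℤ
    ↧x≉0 ↧x≈0 = b≉0 (≈-trans (≈-reflexive (sym ↧x·g≡b)) (≈-trans (*-cong ↧x≈0 (≈-refl {g})) (≈-reflexive (ℤP.*-zeroˡ g))))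
    g≉0 : ¬ g ≈ 0ℤ
    g≉0 g≈0 = b≉0 (≈-trans (≈-reflexive (sym ↧x·g≡b)) (≈-trans (*-cong (≈-refl {↧ x}) g≈0) (≈-reflexive (ℤP.*-zeroʳ (↧ x)))))

  ↦-* : ∀ {x y a b} → x ↦ a → y ↦ b → x ℚ.* y ↦ a * b
  ↦-* {x} {y} {a} {b} (reduces x≉0 x≈) (reduces y≉0 y≈) =
    ↦-fraction (x ℚ.* y) _ (a * b) (ℚP.↥-* x y) (ℚP.↧-* x y) (*-≉0 x≉0 y≉0)
      (≈-trans (*-cong x≈ y≈) (≈-reflexive (rearrange a b (↧ x) (↧ y))))
    where rearrange : ∀ a b c d → (a * c) * (b * d) ≡ (a * b) * (c * d)
          rearrange = solve-∀

  ↦-+ : ∀ {x y a b} → x ↦ a → y ↦ b → x ℚ.+ y ↦ a + b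
  ↦-+ {x} {y} {a} {b} (reduces x≉0 x≈) (reduces y≉0 y≈) =
    ↦-fraction (x ℚ.+ y) _ (a + b) (ℚP.↥-+ x y) (ℚP.↧-+ x y) (*-≉0 x≉0 y≉0)
      (≈-trans (+-cong (*-cong x≈ (≈-refl {↧ y})) (*-cong y≈ (≈-refl {↧ x}))) (≈-reflexive (rearrange a b (↧ x) (↧ y))))
    where rearrange : ∀ a b c d → (a * c) * d + (b * d) * c ≡ (a + b) * (c * d)
          rearrange = solve-∀

  ↦-neg : ∀ {x a} → x ↦ a → ℚ.- x ↦ - a
  ↦-neg {x} {a} (reduces x≉0 x≈) = reduces (x≉0 ∘ subst (_≈ 0ℤ) (ℚP.↧-neg x))
    (≈-trans (≈-reflexive (ℚP.↥-neg x)) (≈-trans (-‿cong x≈)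
             (≈-reflexive (trans (ℤP.neg-distribˡ-* a (↧ x)) (cong (- a *_) (sym (ℚP.↧-neg x)))))))

  ↦-minus : ∀ {x y a b} → x ↦ a → y ↦ b → x ℚ.- y ↦ a - b
  ↦-minus x↦a y↦b = ↦-+ x↦a (↦-neg y↦b)

  0ℚ↦0 : 0ℚ ↦ 0ℤ
  0ℚ↦0 = reduces 1≉0 ≈-refl

  1ℚ↦1 : 1ℚ ↦ 1ℤ
  1ℚ↦1 = reduces 1≉0 ≈-refl

  2ℚ↦2 : (+ 2 / 1) ↦ + 2
  2ℚ↦2 = reduces 1≉0 ≈-refl

  4ℚ↦4 : (+ 4 / 1) ↦ + 4
  4ℚ↦4 = reduces 1≉0 ≈-refl

  ↦-≡0mod : ∀ {x a} → x ↦ a → (x ≡0mod p → a ≈ 0ℤ) × (a ≈ 0ℤ → x ≡0mod p)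
  ↦-≡0mod {x} {a} (reduces x≉0 x≈) =
    (λ p∣↥x → *-cancelˡ x≉0 (≈-trans (≈-reflexive (ℤP.*-comm (↧ x) a))
                (≈-trans (≈-sym x≈) (≈-trans (proj₂ ≈0⇔∣ p∣↥x) (≈-reflexive (sym (ℤP.*-zeroʳ (↧ x))))))))
    , (λ a≈0 → proj₁ ≈0⇔∣ (≈-trans x≈ (≈-trans (*-cong a≈0 (≈-refl {↧ x})) (≈-reflexive (ℤP.*-zeroˡ (↧ x))))))

  inverse : ℤ → ℤ
  inverse a = a ^ (p ℕ.∸ 2)

  inverse-spec : ∀ {a} → ¬ a ≈ 0ℤ → a * inverse a ≈ 1ℤ
  inverse-spec {a} a≉0 = subst (λ n → a ^ n ≈ 1ℤ) (pred≡suc[∸2] p 1<p) (fermat-little a≉0)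
    where pred≡suc[∸2] : ∀ n → 1 ℕ.< n → ℕ.pred n ≡ suc (n ℕ.∸ 2)
          pred≡suc[∸2] (suc (suc n)) _ = refl
          pred≡suc[∸2] (suc zero) (ℕ.s≤s ())

  ↦-legendre : ∀ {x a} → x ↦ a → IsLegendre a (legendre x p)
  ↦-legendre {x} {a} x↦a@(reduces x≉0 x≈) with p ℕD.∣? ℤ.∣ ↥ x ∣
  ... | yes p∣↥x = divisible (proj₁ (↦-≡0mod x↦a) p∣↥x)
  ... | no p∤↥x with any? (λ (y : Fin p) → p ℕD.∣? ℤ.∣ (+ toℕ y * + toℕ y) - (↥ x * + ↧ₙ x) ∣)
  ...   | yes (y , p∣y²-↥x↧x) = residue a≉0 (+ toℕ y * inverse (↧ x) , square-root)
    where
    a≉0 : ¬ a ≈ 0ℤ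
    a≉0 = p∤↥x ∘ proj₂ (↦-≡0mod x↦a)
    d : ℤ
    d = ↧ x
    square-root : (+ toℕ y * inverse d) * (+ toℕ y * inverse d) ≈ a
    square-root = begin
      (+ toℕ y * i) * (+ toℕ y * i)  ≡⟨ rearrange (+ toℕ y) i ⟩
      (+ toℕ y * + toℕ y) * (i * i)  ≈⟨ *-cong y²≈↥x·d (≈-refl {i * i}) ⟩
      (↥ x * d) * (i * i)            ≈⟨ *-cong (*-cong x≈ (≈-refl {d})) (≈-refl {i * i}) ⟩
      ((a * d) * d) * (i * i)        ≡⟨ regroup a d i ⟩
      a * ((d * i) * (d * i))        ≈⟨ *-cong (≈-refl {a}) (*-cong (inverse-spec x≉0) (inverse-spec x≉0)) ⟩
      a * (1ℤ * 1ℤ)                  ≡⟨ ℤP.*-identityʳ a ⟩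
      a ∎
      where
      open import Relation.Binary.Reasoning.Setoid ≈-setoid
      i : ℤ
      i = inverse d
      y²≈↥x·d : + toℕ y * + toℕ y ≈ ↥ x * d
      y²≈↥x·d = -≈0⇒≈ (+ toℕ y * + toℕ y) (↥ x * d) (proj₂ ≈0⇔∣ p∣y²-↥x↧x)
      rearrange : ∀ y i → (y * i) * (y * i) ≡ (y * y) * (i * i)
      rearrange = solve-∀
      regroup : ∀ a d i → ((a * d) * d) * (i * i) ≡ a * ((d * i) * (d * i))
      regroup = solve-∀
  ...   | no no-root = nonresidue a≉0 (λ (s , s²≈a) → no-root (reduced-root s s²≈a))
    where
    a≉0 : ¬ a ≈ 0ℤ
    a≉0 = p∤↥x ∘ proj₂ (↦-≡0mod x↦a)
    reduced-root : ∀ s → s * s ≈ a → Σ (Fin p) λ y → p ℕD.∣ ℤ.∣ (+ toℕ y * + toℕ y) - (↥ x * + ↧ₙ x) ∣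
    reduced-root s s²≈a = y , proj₁ ≈0⇔∣ (begin
      (+ toℕ y * + toℕ y) - (↥ x * d)   ≈⟨ -cong (*-cong y≈z y≈z) (*-cong x≈ (≈-refl {d})) ⟩
      (z * z) - ((a * d) * d)           ≡⟨ cong (_- ((a * d) * d)) (rearrange s d) ⟩
      (s * s) * (d * d) - (a * d) * d   ≈⟨ -cong (*-cong s²≈a (≈-refl {d * d})) (≈-refl {(a * d) * d}) ⟩
      a * (d * d) - (a * d) * d         ≡⟨ cancel a d ⟩
      0ℤ ∎)
      where
      open import Relation.Binary.Reasoning.Setoid ≈-setoid
      d z : ℤ
      d = ↧ x
      z = s * d
      y : Fin p
      y = fromℕ< (ℤDM.n%ℕd<d z p)
      y≈z : + toℕ y ≈ z
      y≈z = ≈-trans (≈-reflexive (cong +_ (FinP.toℕ-fromℕ< (ℤDM.n%ℕd<d z p)))) (≈-sym (≈-%ℕ z))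
      rearrange : ∀ s d → (s * d) * (s * d) ≡ (s * s) * (d * d)
      rearrange = solve-∀
      cancel : ∀ a d → a * (d * d) - (a * d) * d ≡ 0ℤ
      cancel = solve-∀

module ReductionOf (q : ℚ) (p : ℕ) (p-prime : Prime p) (q∉D : ¬ InD q p) where

  open PrimeModulus p p-prime
  open RationalReduction p p-prime
  open import Data.Integer.Base using (_+_; _*_)

  Q : ℤ
  Q = ↥ q * inverse (↧ q)

  open Lucas p p-prime Q using (u; D; T)

  q↦Q : q ↦ Q
  q↦Q = reduces ↧q≉0 (≈-trans (≈-reflexive (sym (ℤP.*-identityʳ (↥ q))))
    (≈-trans (*-cong (≈-refl {↥ q}) (≈-trans (≈-sym (inverse-spec ↧q≉0)) (≈-reflexive (ℤP.*-comm (↧ q) (inverse (↧ q))))))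
             (≈-reflexive (sym (ℤP.*-assoc (↥ q) (inverse (↧ q)) (↧ q))))))
    where ↧q≉0 : ¬ ↧ q ≈ 0ℤ
          ↧q≉0 = q∉D ∘ proj₁ ≈0⇔∣

  U↦u : ∀ n → U q n ↦ u n × U q (suc n) ↦ u (suc n)
  U↦u zero = 0ℚ↦0 , 1ℚ↦1
  U↦u (suc n) = let (Uₙ↦uₙ , Uₙ₊₁↦uₙ₊₁) = U↦u n in Uₙ₊₁↦uₙ₊₁ , ↦-minus (↦-* q↦Q Uₙ₊₁↦uₙ₊₁) Uₙ↦uₙ

  W↦u+u : ∀ j → W q j ↦ u (suc j) + u j
  W↦u+u j = ↦-+ (proj₂ (U↦u j)) (proj₁ (U↦u j))

  δ↦D : δ q ↦ D
  δ↦D = ↦-minus (↦-* q↦Q q↦Q) 4ℚ↦4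

  q+2↦T : q+2 q ↦ T
  q+2↦T = ↦-+ q↦Q 2ℚ↦2

corollary11 : (q : ℚ) (p : ℕ) → Prime p → p ≢ 2 → ¬ InD q p →
    (k : ℕ) → IsIndexOfAppearance q p k →
    (legendre (δ q) p ≢ + 0 → (+ (2 ℕ.* k)) ℤD.∣ (+ p ℤ.- legendre (δ q) p))
    × (legendre (q+2 q) p ≡ -[1+ 0 ] →
        ∃ λ (m : ℤ) → (+ p ℤ.- legendre (δ q) p ≡ + (2 ℕ.* k) ℤ.* m) × OddInt m)
    × (¬ InΠ₀ q p →
        (∃ λ (m : ℤ) → (+ p ℤ.- legendre (δ q) p ≡ + (2 ℕ.* k) ℤ.* m) × OddInt m) →
        legendre (q+2 q) p ≡ -[1+ 0 ])
    × ((∃ λ (t : ℤ) → + p ℤ.- legendre (δ q) p ≡ + 4 ℤ.* t ℤ.+ + 2) → ¬ (2 ℕD.∣ k))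
    × ((r : ℕ) → Prime r → + p ℤ.- legendre (δ q) p ≡ + (2 ℕ.* r) → k ≡ r)
    × (legendre (δ q) p ≡ + 0 → k ≡ p)
corollary11 q p p-prime p≢2 q∉D k (1≤k , U[k]≡0 , U-minimal) =
  2k∣p-LD , LT≡-1⇒odd-quotient , odd-quotient⇒LT≡-1 ∘ Π₀-transfer ,
  p-LD≡2[mod4]⇒k-odd , p-LD≡2r⇒k≡r , LD≡0⇒k≡p
  where
  open PrimeModulus p p-prime
  open RationalReduction p p-prime
  open ReductionOf q p p-prime q∉D
  open Lucas p p-prime Q using (u)
  m : ℕ
  m = proj₁ (odd-prime p-prime p≢2)
  p≡1+2m : p ≡ suc (m ℕ.+ m)
  p≡1+2m = proj₂ (odd-prime p-prime p≢2)
  u[k]≈0 : u k ≈ 0ℤ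
  u[k]≈0 = proj₁ (↦-≡0mod (proj₁ (U↦u k))) U[k]≡0
  u-minimal : ∀ j → 1 ℕ.≤ j → j ℕ.< k → ¬ u j ≈ 0ℤ
  u-minimal j 1≤j j<k u[j]≈0 = U-minimal j 1≤j j<k (proj₂ (↦-≡0mod (proj₁ (U↦u j))) u[j]≈0)
  open IndexOfAppearanceTheorems.OfIndex p p-prime m p≡1+2m Q k 1≤k u[k]≈0 u-minimal
    (↦-legendre δ↦D) (↦-legendre q+2↦T)
  Π₀-transfer : ¬ InΠ₀ q p → ¬ (∃ λ j → u (suc j) ℤ.+ u j ≈ 0ℤ)
  Π₀-transfer ¬Π₀ (j , w≈0) = ¬Π₀ (j , proj₂ (↦-≡0mod (W↦u+u j)) w≈0)
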